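{- Let $k$ be a positive integer. Then the function $\Phi_k$ is multiplicative (i.e. $\Phi_k(mn)=\Phi_k(m)\Phi_k(n)$ whenever $\gcd(m,n)=1$), and for every positive integer $n$, \[ \Phi_k(n)=\begin{cases} n^{k-1} \varphi(n), & \text{if $k$ is odd}; \\[4pt] n^{k-1} \varphi(n) \displaystyle \prod_{\substack{p \mid n\\ p>2}} \left(1-\frac {(-1)^{k(p-1)/4}}{p^{k/2}}\right), & \text{if $k$ is even}, \end{cases} \] where the product runs over the odd primes $p$ dividing $n$.
   Context: For positive integers $k,n$, $\Phi_k(n)$ denotes the number of $k$-tuples $(x_1,\ldots,x_k)\in(\mathbb{Z}/n\mathbb{Z})^k$ such that $\gcd(x_1^2+\cdots+x_k^2,n)=1$. $\varphi$ is Euler's totient function. -}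

module Defs where

open import Data.Nat using (ℕ; zero; suc; _+_; _*_; _∸_; _^_; _≟_)
open import Data.Nat.Divisibility using (_∣?_)
open import Data.Nat.DivMod using (_%_) renaming (_/_ to _div_)
open import Data.Nat.GCD using (gcd)
open import Data.Nat.Primality using (prime?)
open import Data.Nat.Properties using (m^n≢0)
open import Data.Fin using (Fin; toℕ)
open import Data.Vec using (Vec; []; _∷_)
import Data.Vec as Vec
open import Data.List using (List; []; _∷_; length; filter; map; concatMap; allFin; upTo; foldr)
open import Data.Integer using (ℤ; -1ℤ; +_) renaming (_^_ to _^ℤ_)
open import Data.Rational using (ℚ; 1ℚ; _-_; _/_) renaming (_*_ to _*ℚ_)
open import Relation.Nullary.Decidable using (_×-dec_)

-- all k-tuples over Z/nZ, elements of Z/nZ represented by Fin n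
tuples : (k n : ℕ) → List (Vec (Fin n) k)
tuples zero    n = [] ∷ []
tuples (suc k) n = concatMap (λ x → map (x ∷_) (tuples k n)) (allFin n)

sumSq : ∀ {k n} → Vec (Fin n) k → ℕ
sumSq = Vec.foldr _ (λ x s → toℕ x * toℕ x + s) 0

Φ : ℕ → ℕ → ℕ
Φ k n = length (filter (λ v → gcd (sumSq v) n ≟ 1) (tuples k n))

-- Euler's totient: #{ 0 ≤ i < n : gcd(i, n) = 1 }   (φ(1) = 1)
φ : ℕ → ℕ
φ n = length (filter (λ i → gcd i n ≟ 1) (upTo n))

factor : (k i : ℕ) → ℚ
factor k i = 1ℚ - _/_ (-1ℤ ^ℤ ((k * (p ∸ 1)) div 4)) (p ^ (k div 2)) {{m^n≢0 p (k div 2)}}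
  where p = 2 + i

oddPrimeProduct : ℕ → ℕ → ℚ
oddPrimeProduct k n =
  foldr (λ i r → factor k i *ℚ r) 1ℚ
    (filter (λ i → prime? (2 + i) ×-dec (((2 + i) % 2 ≟ 1) ×-dec ((2 + i) ∣? n))) (upTo n))

ℕtoℚ : ℕ → ℚ
ℕtoℚ m = + m / 1

module Submission where

-- Proof outline.
-- * Counting: Φ k n = Ψ k n 0, where Ψ k n a counts x ∈ [0, n)ᵏ with gcd(a + Σ xᵢ², n) = 1;
--   the offset a lets Ψ be defined by recursion on k, so all counting becomes
--   manipulation of finite sums ∑ (FiniteSum, Counting).
-- * Multiplicative: Ψ only sees a mod n; for coprime m, n it is multiplicative (Chinese
--   remainder theorem), and Ψ k (p n) a = pᵏ Ψ k n a when p ∣ n.  Hence everything reduces,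
--   by induction over the prime factorisation, to the value at a prime; at p = 2 it is 2^(k−1).
-- * Odd primes p = 3 + 2t, via N k a = pᵏ − Ψ k p a, the number of solutions of
--   a + Σ xᵢ² ≡ 0: N 1 a ∈ {0, 2} for units a (OddPrime); every residue is a sum of two
--   squares, so N 2 is constant on units (TwoSquares); −1 is a square iff t is odd
--   (MinusOne); adding two coordinates at a time gives a 2 × 2 linear recurrence for N (2j)
--   (Recurrence), whose closed form in ℤ and ℚ yields the prime values (OddPrimeValue).
-- * oddPrimeProduct is unchanged by a repeated prime and gains the factor of a new odd prime
--   (ProductFacts); the induction over factorisations is carried out in Formula, and
--   theorem1 collects the three statements.

open import Defs
open import Data.Nat using (ℕ; _*_; _∸_; _^_; _≥_; _%_)
open import Data.Nat.Coprimality using (Coprime)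
open import Data.Product using (_×_)
open import Data.Rational using () renaming (_*_ to _*ℚ_)
open import Relation.Binary.PropositionalEquality using (_≡_)
open import Data.Nat using (_+_; suc; >-nonZero)
open import Data.Nat.Primality using (Prime)
open import Data.Product using (Σ; _,_)
open import Relation.Binary.PropositionalEquality using (sym; cong; cong₂; subst; module ≡-Reasoning)

module FiniteSum where

  open import Data.Nat
  open import Data.Nat.Properties
  open import Data.Product using (Σ; _×_; _,_)
  open import Data.Sum using (_⊎_; inj₁; inj₂)
  open import Data.Empty using (⊥-elim)
  open import Relation.Nullary using (Dec; yes; no; ¬_)
  open import Relation.Binary.PropositionalEquality
  open import Data.Nat.Tactic.RingSolver using (solve-∀)

  𝟙 : ∀ {p} {P : Set p} → Dec P → ℕ
  𝟙 (yes _) = 1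
  𝟙 (no _)  = 0

  𝟙-yes : ∀ {p} {P : Set p} (d : Dec P) → P → 𝟙 d ≡ 1
  𝟙-yes (yes _) _ = refl
  𝟙-yes (no ¬x) x = ⊥-elim (¬x x)

  𝟙-no : ∀ {p} {P : Set p} (d : Dec P) → ¬ P → 𝟙 d ≡ 0
  𝟙-no (yes x) ¬x = ⊥-elim (¬x x)
  𝟙-no (no _)  _  = refl

  𝟙≤1 : ∀ {p} {P : Set p} (d : Dec P) → 𝟙 d ≤ 1
  𝟙≤1 (yes _) = s≤s z≤n
  𝟙≤1 (no _)  = z≤n

  𝟙-cong : ∀ {p q} {P : Set p} {Q : Set q} → (P → Q) → (Q → P) →
           (d : Dec P) (e : Dec Q) → 𝟙 d ≡ 𝟙 e
  𝟙-cong f g (yes _) (yes _) = refl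
  𝟙-cong f g (yes x) (no ¬y) = ⊥-elim (¬y (f x))
  𝟙-cong f g (no ¬x) (yes y) = ⊥-elim (¬x (g y))
  𝟙-cong f g (no _)  (no _)  = refl

  𝟙≢0 : ∀ {p} {P : Set p} (d : Dec P) → 𝟙 d ≢ 0 → P
  𝟙≢0 (yes x) _ = x
  𝟙≢0 (no _)  h = ⊥-elim (h refl)

  ≤1⇒0⊎1 : ∀ {x} → x ≤ 1 → x ≡ 0 ⊎ x ≡ 1
  ≤1⇒0⊎1 z≤n       = inj₁ refl
  ≤1⇒0⊎1 (s≤s z≤n) = inj₂ refl

  ∑ : ℕ → (ℕ → ℕ) → ℕ
  ∑ zero    f = 0
  ∑ (suc n) f = f 0 + ∑ n (λ i → f (suc i))

  ∑-cong : ∀ n {f g : ℕ → ℕ} → (∀ i → i < n → f i ≡ g i) → ∑ n f ≡ ∑ n g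
  ∑-cong zero    h = refl
  ∑-cong (suc n) h = cong₂ _+_ (h 0 z<s) (∑-cong n (λ i i<n → h (suc i) (s≤s i<n)))

  ∑-ext : ∀ n {f g : ℕ → ℕ} → (∀ i → f i ≡ g i) → ∑ n f ≡ ∑ n g
  ∑-ext n h = ∑-cong n (λ i _ → h i)

  ∑-+ : ∀ n f g → ∑ n (λ i → f i + g i) ≡ ∑ n f + ∑ n g
  ∑-+ zero    f g = refl
  ∑-+ (suc n) f g = trans (cong (f 0 + g 0 +_) (∑-+ n _ _)) (interchange (f 0) (g 0) _ _)
    where
    interchange : ∀ a b c d → a + b + (c + d) ≡ a + c + (b + d)
    interchange = solve-∀

  ∑-*ˡ : ∀ n c f → ∑ n (λ i → c * f i) ≡ c * ∑ n f
  ∑-*ˡ zero    c f = sym (*-zeroʳ c)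
  ∑-*ˡ (suc n) c f = trans (cong (c * f 0 +_) (∑-*ˡ n c _)) (sym (*-distribˡ-+ c (f 0) _))

  ∑-*ʳ : ∀ n c f → ∑ n (λ i → f i * c) ≡ ∑ n f * c
  ∑-*ʳ n c f = trans (∑-ext n (λ i → *-comm (f i) c)) (trans (∑-*ˡ n c f) (*-comm c _))

  ∑-lin : ∀ n a b f g → ∑ n (λ i → a * f i + b * g i) ≡ a * ∑ n f + b * ∑ n g
  ∑-lin n a b f g = trans (∑-+ n (λ i → a * f i) (λ i → b * g i)) (cong₂ _+_ (∑-*ˡ n a f) (∑-*ˡ n b g))

  ∑-const : ∀ n c → ∑ n (λ _ → c) ≡ n * c
  ∑-const zero    c = refl
  ∑-const (suc n) c = cong (c +_) (∑-const n c)

  ∑-split : ∀ a b f → ∑ (a + b) f ≡ ∑ a f + ∑ b (λ i → f (a + i))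
  ∑-split zero    b f = refl
  ∑-split (suc a) b f = trans (cong (f 0 +_) (∑-split a b _)) (sym (+-assoc (f 0) _ _))

  ∑-zero : ∀ n f → (∀ i → i < n → f i ≡ 0) → ∑ n f ≡ 0
  ∑-zero n f h = trans (∑-cong n h) (trans (∑-const n 0) (*-zeroʳ n))

  ∑-mono : ∀ n f g → (∀ i → i < n → f i ≤ g i) → ∑ n f ≤ ∑ n g
  ∑-mono zero    f g h = z≤n
  ∑-mono (suc n) f g h = +-mono-≤ (h 0 z<s) (∑-mono n _ _ (λ i i<n → h (suc i) (s≤s i<n)))

  ∑-swap : ∀ m n (f : ℕ → ℕ → ℕ) →
           ∑ m (λ i → ∑ n (λ j → f i j)) ≡ ∑ n (λ j → ∑ m (λ i → f i j))
  ∑-swap zero    n f = sym (∑-zero n _ (λ _ _ → refl))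
  ∑-swap (suc m) n f = begin
      ∑ n (λ j → f 0 j) + ∑ m (λ i → ∑ n (λ j → f (suc i) j))
    ≡⟨ cong (∑ n (λ j → f 0 j) +_) (∑-swap m n (λ i j → f (suc i) j)) ⟩
      ∑ n (λ j → f 0 j) + ∑ n (λ j → ∑ m (λ i → f (suc i) j))
    ≡⟨ sym (∑-+ n _ _) ⟩
      ∑ n (λ j → f 0 j + ∑ m (λ i → f (suc i) j)) ∎
    where open ≡-Reasoning

  ∑-block : ∀ n m f → ∑ (n * m) f ≡ ∑ n (λ t → ∑ m (λ y → f (t * m + y)))
  ∑-block zero    m f = refl
  ∑-block (suc n) m f = begin
      ∑ (m + n * m) f
    ≡⟨ ∑-split m (n * m) f ⟩
      ∑ m f + ∑ (n * m) (λ i → f (m + i))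
    ≡⟨ cong (∑ m f +_) (∑-block n m _) ⟩
      ∑ m f + ∑ n (λ t → ∑ m (λ y → f (m + (t * m + y))))
    ≡⟨ cong (∑ m f +_) (∑-ext n (λ t → ∑-ext m (λ y → cong f (sym (+-assoc m (t * m) y))))) ⟩
      ∑ m f + ∑ n (λ t → ∑ m (λ y → f (suc t * m + y))) ∎
    where open ≡-Reasoning

  ∑-periodic : ∀ c m f → (∀ t y → f (t * m + y) ≡ f y) → ∑ (c * m) f ≡ c * ∑ m f
  ∑-periodic c m f per =
    trans (∑-block c m f) (trans (∑-ext c (λ t → ∑-ext m (per t))) (∑-const c (∑ m f)))

  ∑-nonzero : ∀ n f → ∑ n f ≢ 0 → Σ ℕ λ t → t < n × f t ≢ 0
  ∑-nonzero zero    f h = ⊥-elim (h refl)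
  ∑-nonzero (suc n) f h with f 0 ≟ 0
  ... | no f0≢0 = 0 , z<s , f0≢0
  ... | yes f0≡0 with ∑-nonzero n (λ i → f (suc i)) (λ e → h (cong₂ _+_ f0≡0 e))
  ...   | t , t<n , ft≢0 = suc t , s≤s t<n , ft≢0

  ∑-delta : ∀ n j g → j < n → ∑ n (λ i → 𝟙 (i ≟ j) * g i) ≡ g j
  ∑-delta (suc n) zero g _ =
    trans (cong₂ _+_ (+-identityʳ (g 0))
                     (∑-zero n _ (λ i _ → cong (_* g (suc i)) (𝟙-no (suc i ≟ 0) (λ ())))))
          (+-identityʳ (g 0))
  ∑-delta (suc n) (suc j) g (s≤s j<n) =
    trans (cong₂ _+_ (cong (_* g 0) (𝟙-no (0 ≟ suc j) (λ ())))
                     (∑-ext n (λ i → cong (_* g (suc i)) (𝟙-cong suc-injective (cong suc) (suc i ≟ suc j) (i ≟ j)))))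
          (∑-delta n j (λ i → g (suc i)) j<n)

  ∑-point : ∀ n j → j < n → ∑ n (λ i → 𝟙 (i ≟ j) * 1) ≡ 1
  ∑-point n j j<n = ∑-delta n j (λ _ → 1) j<n

  ∑-reindex : ∀ N M (h w g : ℕ → ℕ) → (∀ t → t < N → h t < M) →
    ∑ N (λ t → w t * g (h t)) ≡ ∑ M (λ z → g z * ∑ N (λ t → w t * 𝟙 (h t ≟ z)))
  ∑-reindex N M h w g hM = begin
      ∑ N (λ t → w t * g (h t))
    ≡⟨ ∑-cong N (λ t t<N → cong (w t *_) (sym (∑-delta′ (h t) (hM t t<N)))) ⟩
      ∑ N (λ t → w t * ∑ M (λ z → 𝟙 (h t ≟ z) * g z))
    ≡⟨ ∑-ext N (λ t → sym (∑-*ˡ M (w t) _)) ⟩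
      ∑ N (λ t → ∑ M (λ z → w t * (𝟙 (h t ≟ z) * g z)))
    ≡⟨ ∑-swap N M (λ t z → w t * (𝟙 (h t ≟ z) * g z)) ⟩
      ∑ M (λ z → ∑ N (λ t → w t * (𝟙 (h t ≟ z) * g z)))
    ≡⟨ ∑-ext M (λ z → trans (∑-ext N (λ t → rearrange (w t) (𝟙 (h t ≟ z)) (g z))) (∑-*ˡ N (g z) _)) ⟩
      ∑ M (λ z → g z * ∑ N (λ t → w t * 𝟙 (h t ≟ z))) ∎
    where
    open ≡-Reasoning
    rearrange : ∀ a b c → a * (b * c) ≡ c * (a * b)
    rearrange = solve-∀
    ∑-delta′ : ∀ j → j < M → ∑ M (λ i → 𝟙 (j ≟ i) * g i) ≡ g j
    ∑-delta′ j j<M = trans (∑-ext M (λ i → cong (_* g i) (𝟙-cong sym sym (j ≟ i) (i ≟ j)))) (∑-delta M j g j<M)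

  fibre≤1 : ∀ N (h w : ℕ → ℕ) → (∀ t → t < N → w t ≤ 1) →
    (∀ t t' → t < N → t' < N → w t ≡ 1 → w t' ≡ 1 → h t ≡ h t' → t ≡ t') →
    ∀ z → ∑ N (λ t → w t * 𝟙 (h t ≟ z)) ≤ 1
  fibre≤1 zero    h w w≤1 inj z = z≤n
  fibre≤1 (suc N) h w w≤1 inj z = headCase (≤1⇒0⊎1 (w≤1 0 z<s)) (h 0 ≟ z)
    where
    rest : ℕ
    rest = ∑ N (λ t → w (suc t) * 𝟙 (h (suc t) ≟ z))
    rest≤1 : rest ≤ 1
    rest≤1 = fibre≤1 N _ _ (λ t t<N → w≤1 (suc t) (s≤s t<N))
               (λ t t' t<N t'<N a b e → suc-injective (inj (suc t) (suc t') (s≤s t<N) (s≤s t'<N) a b e)) z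
    rest≡0 : w 0 ≡ 1 → h 0 ≡ z → rest ≡ 0
    rest≡0 w0≡1 h0≡z = ∑-zero N _ otherTerm
      where
      otherTerm : ∀ t → t < N → w (suc t) * 𝟙 (h (suc t) ≟ z) ≡ 0
      otherTerm t t<N with ≤1⇒0⊎1 (w≤1 (suc t) (s≤s t<N)) | h (suc t) ≟ z
      ... | inj₁ wt≡0 | _ rewrite wt≡0 = refl
      ... | inj₂ _    | no _ = *-zeroʳ (w (suc t))
      ... | inj₂ wt≡1 | yes ht≡z with inj 0 (suc t) z<s (s≤s t<N) w0≡1 wt≡1 (trans h0≡z (sym ht≡z))
      ...   | ()
    headCase : w 0 ≡ 0 ⊎ w 0 ≡ 1 → (d : Dec (h 0 ≡ z)) → w 0 * 𝟙 d + rest ≤ 1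
    headCase (inj₁ w0≡0) d = subst (λ x → x * 𝟙 d + rest ≤ 1) (sym w0≡0) rest≤1
    headCase (inj₂ _) (no _) = subst (λ x → x + rest ≤ 1) (sym (*-zeroʳ (w 0))) rest≤1
    headCase (inj₂ w0≡1) (yes h0≡z) =
      subst (λ x → x * 1 + rest ≤ 1) (sym w0≡1) (≤-reflexive (cong suc (rest≡0 w0≡1 h0≡z)))

  all-one : ∀ M (c : ℕ → ℕ) → (∀ z → z < M → c z ≤ 1) → ∑ M c ≡ M → ∀ z → z < M → c z ≡ 1
  all-one (suc M) c c≤1 sum≡M z z<M with ≤1⇒0⊎1 (c≤1 0 z<s)
  ... | inj₁ c0≡0 = ⊥-elim (<-irrefl refl (subst (_≤ M) sum≡M′ restSum≤M))
    where
    sum≡M′ : ∑ M (λ i → c (suc i)) ≡ suc M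
    sum≡M′ = trans (sym (cong (_+ ∑ M (λ i → c (suc i))) c0≡0)) sum≡M
    restSum≤M : ∑ M (λ i → c (suc i)) ≤ M
    restSum≤M = subst (∑ M (λ i → c (suc i)) ≤_) (trans (∑-const M 1) (*-identityʳ M))
                  (∑-mono M _ _ (λ i i<M → c≤1 (suc i) (s≤s i<M)))
  ... | inj₂ c0≡1 with z
  ...   | zero   = c0≡1
  ...   | suc z' = all-one M (λ i → c (suc i)) (λ i i<M → c≤1 (suc i) (s≤s i<M))
                     (suc-injective (trans (cong (_+ ∑ M (λ i → c (suc i))) (sym c0≡1)) sum≡M)) z' (s<s⁻¹ z<M)

  perm-fibre : ∀ N (h : ℕ → ℕ) → (∀ t → t < N → h t < N) →
    (∀ t t' → t < N → t' < N → h t ≡ h t' → t ≡ t') →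
    ∀ z → z < N → ∑ N (λ t → 1 * 𝟙 (h t ≟ z)) ≡ 1
  perm-fibre N h hN inj = all-one N fibre fibre≤1′ total
    where
    fibre : ℕ → ℕ
    fibre z = ∑ N (λ t → 1 * 𝟙 (h t ≟ z))
    fibre≤1′ : ∀ z → z < N → fibre z ≤ 1
    fibre≤1′ z _ = fibre≤1 N h (λ _ → 1) (λ _ _ → ≤-refl) (λ t t' a b _ _ → inj t t' a b) z
    total : ∑ N fibre ≡ N
    total = begin
        ∑ N fibre                ≡⟨ ∑-ext N (λ z → sym (*-identityˡ (fibre z))) ⟩
        ∑ N (λ z → 1 * fibre z)  ≡⟨ sym (∑-reindex N N h (λ _ → 1) (λ _ → 1) hN) ⟩
        ∑ N (λ _ → 1 * 1)        ≡⟨ ∑-const N 1 ⟩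
        N * 1                    ≡⟨ *-identityʳ N ⟩
        N                        ∎
      where open ≡-Reasoning

  ∑-perm : ∀ N (h g : ℕ → ℕ) → (∀ t → t < N → h t < N) →
    (∀ t t' → t < N → t' < N → h t ≡ h t' → t ≡ t') →
    ∑ N (λ t → g (h t)) ≡ ∑ N g
  ∑-perm N h g hN inj = begin
      ∑ N (λ t → g (h t))
    ≡⟨ ∑-ext N (λ t → sym (+-identityʳ (g (h t)))) ⟩
      ∑ N (λ t → 1 * g (h t))
    ≡⟨ ∑-reindex N N h (λ _ → 1) g hN ⟩
      ∑ N (λ z → g z * ∑ N (λ t → 1 * 𝟙 (h t ≟ z)))
    ≡⟨ ∑-cong N (λ z z<N → trans (cong (g z *_) (perm-fibre N h hN inj z z<N)) (*-identityʳ (g z))) ⟩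
      ∑ N g ∎
    where open ≡-Reasoning

  perm-surj : ∀ N (h : ℕ → ℕ) → (∀ t → t < N → h t < N) →
    (∀ t t' → t < N → t' < N → h t ≡ h t' → t ≡ t') →
    ∀ z → z < N → Σ ℕ λ t → t < N × h t ≡ z
  perm-surj N h hN inj z z<N with ∑-nonzero N (λ t → 1 * 𝟙 (h t ≟ z)) fibre≢0
    where
    fibre≢0 : ∑ N (λ t → 1 * 𝟙 (h t ≟ z)) ≢ 0
    fibre≢0 e = 1≢0 (trans (sym (perm-fibre N h hN inj z z<N)) e)
      where 1≢0 : 1 ≢ 0
            1≢0 ()
  ... | t , t<N , ht≢0 = t , t<N , 𝟙≢0 (h t ≟ z) (λ e → ht≢0 (trans (+-identityʳ _) e))

  ∑-inj≤ : ∀ N M (h w v : ℕ → ℕ) → (∀ t → t < N → h t < M) → (∀ t → t < N → w t ≤ 1) →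
    (∀ z → z < M → v z ≤ 1) →
    (∀ t → t < N → w t ≡ 1 → v (h t) ≡ 1) →
    (∀ t t' → t < N → t' < N → w t ≡ 1 → w t' ≡ 1 → h t ≡ h t' → t ≡ t') →
    ∑ N w ≤ ∑ M v
  ∑-inj≤ N M h w v hM w≤1 v≤1 wv inj = begin
      ∑ N w
    ≡⟨ ∑-cong N weight ⟩
      ∑ N (λ t → w t * v (h t))
    ≡⟨ ∑-reindex N M h w v hM ⟩
      ∑ M (λ z → v z * ∑ N (λ t → w t * 𝟙 (h t ≟ z)))
    ≤⟨ ∑-mono M _ _ (λ z _ → fibre-bound z) ⟩
      ∑ M v ∎
    where
    open ≤-Reasoning
    fibre-bound : ∀ z → v z * ∑ N (λ t → w t * 𝟙 (h t ≟ z)) ≤ v z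
    fibre-bound z = subst (v z * ∑ N (λ t → w t * 𝟙 (h t ≟ z)) ≤_) (*-identityʳ (v z))
                          (*-monoʳ-≤ (v z) (fibre≤1 N h w w≤1 inj z))
    weight : ∀ t → t < N → w t ≡ w t * v (h t)
    weight t t<N with ≤1⇒0⊎1 (w≤1 t t<N)
    ... | inj₁ wt≡0 rewrite wt≡0 = refl
    ... | inj₂ wt≡1 rewrite wt≡1 | wv t t<N wt≡1 = refl

  pigeonhole : ∀ n f g → (∀ i → i < n → f i ≤ 1) → (∀ i → i < n → g i ≤ 1) →
    n < ∑ n f + ∑ n g → Σ ℕ λ i → i < n × f i ≡ 1 × g i ≡ 1
  pigeonhole zero    f g f≤1 g≤1 ()
  pigeonhole (suc n) f g f≤1 g≤1 lt = headOrTail (≤1⇒0⊎1 (f≤1 0 z<s)) (≤1⇒0⊎1 (g≤1 0 z<s))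
    where
    F G : ℕ → ℕ
    F i = f (suc i)
    G i = g (suc i)
    interchange : ∀ a A b B → (a + A) + (b + B) ≡ (a + b) + (A + B)
    interchange = solve-∀
    inTail : f 0 + g 0 ≤ 1 → Σ ℕ λ i → i < suc n × f i ≡ 1 × g i ≡ 1
    inTail head≤1 with pigeonhole n F G (λ i i<n → f≤1 (suc i) (s≤s i<n)) (λ i i<n → g≤1 (suc i) (s≤s i<n))
                         (s<s⁻¹ (≤-trans lt (≤-trans (≤-reflexive (interchange (f 0) (∑ n F) (g 0) (∑ n G)))
                                                     (+-monoˡ-≤ (∑ n F + ∑ n G) head≤1))))
    ... | i , i<n , fi , gi = suc i , s≤s i<n , fi , gi
    headOrTail : f 0 ≡ 0 ⊎ f 0 ≡ 1 → g 0 ≡ 0 ⊎ g 0 ≡ 1 → Σ ℕ λ i → i < suc n × f i ≡ 1 × g i ≡ 1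
    headOrTail (inj₂ f0≡1) (inj₂ g0≡1) = 0 , z<s , f0≡1 , g0≡1
    headOrTail (inj₁ f0≡0) _ = inTail (subst (λ x → x + g 0 ≤ 1) (sym f0≡0) (g≤1 0 z<s))
    headOrTail (inj₂ _) (inj₁ g0≡0) =
      inTail (subst (λ x → f 0 + x ≤ 1) (sym g0≡0) (subst (_≤ 1) (sym (+-identityʳ (f 0))) (f≤1 0 z<s)))

  ∑-even : ∀ n f → (∀ i → i < n → f i ≡ 0 ⊎ f i ≡ 2) → Σ ℕ λ e → ∑ n f ≡ 2 * e
  ∑-even zero    f h = 0 , refl
  ∑-even (suc n) f h with h 0 z<s | ∑-even n (λ i → f (suc i)) (λ i i<n → h (suc i) (s≤s i<n))
  ... | inj₁ f0≡0 | e , rest = e , cong₂ _+_ f0≡0 rest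
  ... | inj₂ f0≡2 | e , rest = suc e , trans (cong₂ _+_ f0≡2 rest) (l e)
    where
    l : ∀ e → 2 + 2 * e ≡ 2 * suc e
    l = solve-∀

module Congruence where

  open import Data.Nat
  open import Data.Nat.Properties
  open import Data.Nat.DivMod
  open import Data.Nat.Divisibility
  open import Data.Nat.Coprimality using (Coprime; coprime-divisor)
  open import Data.Product using (Σ; _,_)
  open import Data.Sum using (inj₁; inj₂)
  open import Relation.Nullary using (contradiction)
  open import Relation.Binary.PropositionalEquality
  open import Data.Nat.Tactic.RingSolver using (solve-∀)

  -- Congruence modulo n on ℕ, witnessed without subtraction: a + q n = b + r n.
  infix 4 _≡[_]_
  _≡[_]_ : ℕ → ℕ → ℕ → Set
  a ≡[ n ] b = Σ ℕ λ q → Σ ℕ λ r → a + q * n ≡ b + r * n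

  mod-refl : ∀ {n} a → a ≡[ n ] a
  mod-refl a = 0 , 0 , refl

  mod-≡ : ∀ {n a b} → a ≡ b → a ≡[ n ] b
  mod-≡ {a = a} refl = mod-refl a

  mod-sym : ∀ {n a b} → a ≡[ n ] b → b ≡[ n ] a
  mod-sym (q , r , e) = r , q , sym e

  mod-trans : ∀ {n a b c} → a ≡[ n ] b → b ≡[ n ] c → a ≡[ n ] c
  mod-trans {n} {a} {b} {c} (q , r , e) (s , u , f) = q + s , r + u , (begin
      a + (q + s) * n     ≡⟨ l₁ a q s n ⟩
      (a + q * n) + s * n ≡⟨ cong (_+ s * n) e ⟩
      (b + r * n) + s * n ≡⟨ l₂ b r s n ⟩
      (b + s * n) + r * n ≡⟨ cong (_+ r * n) f ⟩
      (c + u * n) + r * n ≡⟨ l₃ c u r n ⟩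
      c + (r + u) * n     ∎)
    where
    open ≡-Reasoning
    l₁ : ∀ a q s n → a + (q + s) * n ≡ (a + q * n) + s * n
    l₁ = solve-∀
    l₂ : ∀ b r s n → (b + r * n) + s * n ≡ (b + s * n) + r * n
    l₂ = solve-∀
    l₃ : ∀ c u r n → (c + u * n) + r * n ≡ c + (r + u) * n
    l₃ = solve-∀

  mod-+ : ∀ {n a b c d} → a ≡[ n ] b → c ≡[ n ] d → a + c ≡[ n ] b + d
  mod-+ {n} {a} {b} {c} {d} (q , r , e) (s , u , f) = q + s , r + u , (begin
      a + c + (q + s) * n       ≡⟨ l a c q s n ⟩
      (a + q * n) + (c + s * n) ≡⟨ cong₂ _+_ e f ⟩
      (b + r * n) + (d + u * n) ≡⟨ sym (l b d r u n) ⟩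
      b + d + (r + u) * n       ∎)
    where
    open ≡-Reasoning
    l : ∀ a c q s n → a + c + (q + s) * n ≡ (a + q * n) + (c + s * n)
    l = solve-∀

  mod-* : ∀ {n a b c d} → a ≡[ n ] b → c ≡[ n ] d → a * c ≡[ n ] b * d
  mod-* {n} {a} {b} {c} {d} (q , r , e) (s , u , f) =
    q * c + a * s + q * s * n , r * d + b * u + r * u * n , (begin
      a * c + (q * c + a * s + q * s * n) * n ≡⟨ l a c q s n ⟩
      (a + q * n) * (c + s * n)               ≡⟨ cong₂ _*_ e f ⟩
      (b + r * n) * (d + u * n)               ≡⟨ sym (l b d r u n) ⟩
      b * d + (r * d + b * u + r * u * n) * n ∎)
    where
    open ≡-Reasoning
    l : ∀ a c q s n → a * c + (q * c + a * s + q * s * n) * n ≡ (a + q * n) * (c + s * n)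
    l = solve-∀

  mod-+ˡ : ∀ {n a b} c → a ≡[ n ] b → c + a ≡[ n ] c + b
  mod-+ˡ c h = mod-+ (mod-refl c) h

  mod-+ʳ : ∀ {n a b} c → a ≡[ n ] b → a + c ≡[ n ] b + c
  mod-+ʳ c h = mod-+ h (mod-refl c)

  mod-*ˡ : ∀ {n a b} c → a ≡[ n ] b → c * a ≡[ n ] c * b
  mod-*ˡ c h = mod-* (mod-refl c) h

  mod-*ʳ : ∀ {n a b} c → a ≡[ n ] b → a * c ≡[ n ] b * c
  mod-*ʳ c h = mod-* h (mod-refl c)

  mod-+cancelʳ : ∀ {n a b} c → a + c ≡[ n ] b + c → a ≡[ n ] b
  mod-+cancelʳ {n} {a} {b} c (q , r , e) =
    q , r , +-cancelʳ-≡ c _ _ (trans (l a c q n) (trans e (sym (l b c r n))))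
    where
    l : ∀ a c q n → a + q * n + c ≡ a + c + q * n
    l = solve-∀

  mod-+cancelˡ : ∀ {n a b} c → c + a ≡[ n ] c + b → a ≡[ n ] b
  mod-+cancelˡ {n} {a} {b} c h = mod-+cancelʳ c (subst₂ (λ u v → u ≡[ n ] v) (+-comm c a) (+-comm c b) h)

  mod-multiple : ∀ {n} a k → a + k * n ≡[ n ] a
  mod-multiple a k = 0 , k , +-identityʳ _

  mod-self : ∀ {n} → n ≡[ n ] 0
  mod-self {n} = 0 , 1 , trans (+-identityʳ n) (sym (+-identityʳ n))

  mod-% : ∀ {n} .{{_ : NonZero n}} a → a % n ≡[ n ] a
  mod-% {n} a = a / n , 0 , trans (sym (m≡m%n+[m/n]*n a n)) (sym (+-identityʳ a))

  %-mod : ∀ {n} .{{_ : NonZero n}} {a b} → a % n ≡ b % n → a ≡[ n ] b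
  %-mod {n} {a} {b} e = mod-trans (mod-sym (mod-% a)) (mod-trans (mod-≡ e) (mod-% b))

  mod-∣ : ∀ {n a b d} → d ∣ n → a ≡[ n ] b → d ∣ b → d ∣ a
  mod-∣ {n} {a} {b} {d} d∣n (q , r , e) d∣b =
    ∣m+n∣m⇒∣n (subst (d ∣_) (trans (sym e) (+-comm a (q * n))) (∣m∣n⇒∣m+n d∣b (∣n⇒∣m*n r d∣n)))
              (∣n⇒∣m*n q d∣n)

  mod-0⇒∣ : ∀ {n a} → a ≡[ n ] 0 → n ∣ a
  mod-0⇒∣ h = mod-∣ ∣-refl h (_∣0 _)

  ∣⇒mod-0 : ∀ {n a} → n ∣ a → a ≡[ n ] 0
  ∣⇒mod-0 {n} {a} (divides q e) = 0 , q , trans (+-identityʳ a) e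

  mod-∸ : ∀ {n a b} → a ≤ b → a ≡[ n ] b → n ∣ b ∸ a
  mod-∸ {n} {a} {b} a≤b (q , r , e) = divides (q ∸ r) (begin
      b ∸ a                   ≡⟨ sym ([m+n]∸[m+o]≡n∸o (r * n) b a) ⟩
      r * n + b ∸ (r * n + a) ≡⟨ cong₂ _∸_ (trans (+-comm (r * n) b) (sym e)) (+-comm (r * n) a) ⟩
      a + q * n ∸ (a + r * n) ≡⟨ [m+n]∸[m+o]≡n∸o a (q * n) (r * n) ⟩
      q * n ∸ r * n           ≡⟨ sym (*-distribʳ-∸ n q r) ⟩
      (q ∸ r) * n             ∎)
    where open ≡-Reasoning

  ∣-small : ∀ {n d} → n ∣ d → d < n → d ≡ 0
  ∣-small {n} {zero}  _   _   = refl
  ∣-small {n} {suc d} n∣d d<n = contradiction n∣d (>⇒∤ d<n)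

  mod-cancel≤ : ∀ {n c a b} → Coprime n c → a ≤ b → a * c ≡[ n ] b * c → a ≡[ n ] b
  mod-cancel≤ {n} {c} {a} {b} cop a≤b ac≡bc
    with coprime-divisor cop (subst (n ∣_) (trans (sym (*-distribʳ-∸ c b a)) (*-comm (b ∸ a) c)) (mod-∸ (*-monoˡ-≤ c a≤b) ac≡bc))
  ... | divides k b-a≡kn = mod-sym (0 , k , trans (+-identityʳ b) (trans (sym (m+[n∸m]≡n a≤b)) (cong (a +_) b-a≡kn)))

  mod-cancel : ∀ {n c a b} → Coprime n c → a * c ≡[ n ] b * c → a ≡[ n ] b
  mod-cancel {a = a} {b} cop ac≡bc with ≤-total a b
  ... | inj₁ a≤b = mod-cancel≤ cop a≤b ac≡bc
  ... | inj₂ b≤a = mod-sym (mod-cancel≤ cop b≤a (mod-sym ac≡bc))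

  mod-small≤ : ∀ {n a b} → a ≤ b → b < n → a ≡[ n ] b → a ≡ b
  mod-small≤ {n} {a} {b} a≤b b<n a≡b =
    sym (trans (sym (m+[n∸m]≡n a≤b)) (trans (cong (a +_) (∣-small (mod-∸ a≤b a≡b) (≤-<-trans (m∸n≤m b a) b<n))) (+-identityʳ a)))

  mod-small : ∀ {n a b} → a < n → b < n → a ≡[ n ] b → a ≡ b
  mod-small {a = a} {b} a<n b<n a≡b with ≤-total a b
  ... | inj₁ a≤b = mod-small≤ a≤b b<n a≡b
  ... | inj₂ b≤a = sym (mod-small≤ b≤a a<n (mod-sym a≡b))

  %-affine-injective : ∀ {n m} .{{_ : NonZero n}} y → Coprime n m →
    ∀ t t' → t < n → t' < n → (t * m + y) % n ≡ (t' * m + y) % n → t ≡ t'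
  %-affine-injective y cop t t' t<n t'<n e =
    mod-small t<n t'<n (mod-cancel cop (mod-+cancelʳ y (%-mod e)))

  mod-square-shift : ∀ n t y → (t * n + y) * (t * n + y) ≡[ n ] y * y
  mod-square-shift n t y = subst (_≡[ n ] y * y) (sym (l n t y)) (mod-multiple (y * y) (t * t * n + 2 * t * y))
    where
    l : ∀ n t y → (t * n + y) * (t * n + y) ≡ y * y + (t * t * n + 2 * t * y) * n
    l = solve-∀

module Counting where

  open import Data.Nat
  open import Data.Nat.Properties
  open import Data.Nat.GCD using (gcd; gcd-comm)
  open import Data.Nat.Coprimality using (Coprime; coprime⇒gcd≡1; gcd≡1⇒coprime; coprime-divisor)
  open import Data.Nat.Divisibility using (∣-trans; m∣m*n)
  open import Data.Product using (_,_)
  open import Data.List using (List; []; _∷_; length; filter; map; concatMap; applyUpTo; tabulate; _++_)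
  open import Data.List.Properties using (filter-++; length-++; filter-≐)
  open import Data.Fin using (Fin; toℕ)
  import Data.Fin as Fin
  import Data.Vec as Vec
  open import Relation.Nullary using (yes; no)
  open import Relation.Unary using (Pred; Decidable)
  open import Relation.Binary.PropositionalEquality
  open import Defs
  open FiniteSum

  -- Ψ k n a = #{ x ∈ [0, n)ᵏ : gcd(a + x₁² + ⋯ + xₖ², n) = 1 }, by recursion on k.
  -- Carrying the offset a makes every counting argument a manipulation of finite sums;
  -- Φ k n = Ψ k n 0 and φ n = Ψ 1 n 0.
  Ψ : ℕ → ℕ → ℕ → ℕ
  Ψ zero    n a = 𝟙 (gcd a n ≟ 1)
  Ψ (suc k) n a = ∑ n (λ x → Ψ k n (a + x * x))

  module _ {a p} {A : Set a} {P : Pred A p} (P? : Decidable P) where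

    count-∷ : ∀ x xs → length (filter P? (x ∷ xs)) ≡ 𝟙 (P? x) + length (filter P? xs)
    count-∷ x xs with P? x
    ... | yes _ = refl
    ... | no _  = refl

    count-++ : ∀ xs ys → length (filter P? (xs ++ ys)) ≡ length (filter P? xs) + length (filter P? ys)
    count-++ xs ys = trans (cong length (filter-++ P? xs ys)) (length-++ (filter P? xs))

    count-applyUpTo : ∀ m (f : ℕ → A) → length (filter P? (applyUpTo f m)) ≡ ∑ m (λ i → 𝟙 (P? (f i)))
    count-applyUpTo zero    f = refl
    count-applyUpTo (suc m) f = trans (count-∷ (f 0) _) (cong (𝟙 (P? (f 0)) +_) (count-applyUpTo m (λ i → f (suc i))))

    count-concatMap : ∀ n (f : Fin n → List A) (c : ℕ → ℕ) →
      (∀ i → length (filter P? (f i)) ≡ c (toℕ i)) →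
      length (filter P? (concatMap f (tabulate (λ i → i)))) ≡ ∑ n c
    count-concatMap n f = go n (λ i → i)
      where
      go : ∀ m (e : Fin m → Fin n) (c : ℕ → ℕ) → (∀ i → length (filter P? (f (e i))) ≡ c (toℕ i)) →
           length (filter P? (concatMap f (tabulate e))) ≡ ∑ m c
      go zero    e c h = refl
      go (suc m) e c h = trans (count-++ (f (e Fin.zero)) _)
                               (cong₂ _+_ (h Fin.zero) (go m (λ i → e (Fin.suc i)) (λ i → c (suc i)) (λ i → h (Fin.suc i))))

  count-map : ∀ {a b p} {A : Set a} {B : Set b} {P : Pred B p} (P? : Decidable P) (h : A → B) xs →
    length (filter P? (map h xs)) ≡ length (filter (λ x → P? (h x)) xs)
  count-map P? h []       = refl
  count-map P? h (x ∷ xs) =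
    trans (count-∷ P? (h x) (map h xs))
          (trans (cong (𝟙 (P? (h x)) +_) (count-map P? h xs)) (sym (count-∷ (λ x → P? (h x)) x xs)))

  Φ-offset : ∀ k n a → length (filter (λ v → gcd (a + sumSq v) n ≟ 1) (tuples k n)) ≡ Ψ k n a
  Φ-offset zero n a =
    trans (count-∷ (λ v → gcd (a + sumSq v) n ≟ 1) Vec.[] [])
          (trans (+-identityʳ _) (cong (λ z → 𝟙 (gcd z n ≟ 1)) (+-identityʳ a)))
  Φ-offset (suc k) n a = count-concatMap _ n _ (λ x → Ψ k n (a + x * x)) λ i →
    trans (count-map _ (i Vec.∷_) (tuples k n))
     (trans (cong length (filter-≐ _ (λ v → gcd ((a + toℕ i * toℕ i) + sumSq v) n ≟ 1)
               ((λ {v} → subst (λ z → gcd z n ≡ 1) (sym (+-assoc a _ (sumSq v))))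
               , (λ {v} → subst (λ z → gcd z n ≡ 1) (+-assoc a _ (sumSq v))))
               (tuples k n)))
       (Φ-offset k n (a + toℕ i * toℕ i)))

  Φ≡Ψ : ∀ k n → Φ k n ≡ Ψ k n 0
  Φ≡Ψ k n = Φ-offset k n 0

  gcd≡1⇒coprime′ : ∀ a n → gcd a n ≡ 1 → Coprime n a
  gcd≡1⇒coprime′ a n e = gcd≡1⇒coprime (trans (gcd-comm n a) e)

  coprime′⇒gcd≡1 : ∀ a n → Coprime n a → gcd a n ≡ 1
  coprime′⇒gcd≡1 a n c = trans (gcd-comm a n) (coprime⇒gcd≡1 c)

  coprime-*ʳ : ∀ {n a b} → Coprime n a → Coprime n b → Coprime n (a * b)
  coprime-*ʳ {n} {a} {b} ca cb {d} (d∣n , d∣ab) = cb (d∣n , coprime-divisor cda d∣ab)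
    where
    cda : Coprime d a
    cda (e∣d , e∣a) = ca (∣-trans e∣d d∣n , e∣a)

  coprime-square : ∀ {n x} → Coprime n (x * x) → Coprime n x
  coprime-square c (d∣n , d∣x) = c (d∣n , ∣-trans d∣x (m∣m*n _))

  φ≡Ψ : ∀ n → φ n ≡ Ψ 1 n 0
  φ≡Ψ n = trans (count-applyUpTo (λ i → gcd i n ≟ 1) n (λ i → i)) (∑-ext n (λ i → 𝟙-cong (square⇒ i) (⇒square i) _ _))
    where
    square⇒ : ∀ i → gcd i n ≡ 1 → gcd (i * i) n ≡ 1
    square⇒ i e = coprime′⇒gcd≡1 (i * i) n (coprime-*ʳ (gcd≡1⇒coprime′ i n e) (gcd≡1⇒coprime′ i n e))
    ⇒square : ∀ i → gcd (i * i) n ≡ 1 → gcd i n ≡ 1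
    ⇒square i e = coprime′⇒gcd≡1 i n (coprime-square (gcd≡1⇒coprime′ (i * i) n e))

module Multiplicative where

  open import Data.Nat
  open import Data.Nat.Properties
  open import Data.Nat.DivMod using (_%_; m%n<n)
  open import Data.Nat.Divisibility using (_∣_; ∣-trans; ∣m⇒∣m*n; ∣n⇒∣m*n; *-monoˡ-∣)
  open import Data.Nat.GCD using (gcd; gcd-zeroʳ)
  open import Data.Nat.Coprimality using (Coprime) renaming (sym to coprime-sym)
  open import Data.Product using (_×_; _,_; proj₁; proj₂)
  open import Relation.Nullary using (yes; no)
  open import Relation.Binary.PropositionalEquality
  open import Data.Nat.Tactic.RingSolver using (solve-∀)
  open FiniteSum
  open Congruence
  open Counting

  Ψ-mod : ∀ k n a b → a ≡[ n ] b → Ψ k n a ≡ Ψ k n b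
  Ψ-mod zero n a b a≡b = 𝟙-cong
    (λ e → coprime′⇒gcd≡1 b n (λ { (d∣n , d∣b) → gcd≡1⇒coprime′ a n e (d∣n , mod-∣ d∣n a≡b d∣b) }))
    (λ e → coprime′⇒gcd≡1 a n (λ { (d∣n , d∣a) → gcd≡1⇒coprime′ b n e (d∣n , mod-∣ d∣n (mod-sym a≡b) d∣a) }))
    _ _
  Ψ-mod (suc k) n a b a≡b = ∑-ext n (λ x → Ψ-mod k n _ _ (mod-+ʳ (x * x) a≡b))

  Ψ-periodic : ∀ k n a t y → Ψ k n (a + (t * n + y) * (t * n + y)) ≡ Ψ k n (a + y * y)
  Ψ-periodic k n a t y = Ψ-mod k n _ _ (mod-+ˡ a (mod-square-shift n t y))

  coprime-*ˡ⇒ : ∀ {m n a} → Coprime (m * n) a → Coprime m a × Coprime n a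
  coprime-*ˡ⇒ {m} {n} c = (λ { (d∣m , d∣a) → c (∣m⇒∣m*n n d∣m , d∣a) })
                        , (λ { (d∣n , d∣a) → c (∣n⇒∣m*n m d∣n , d∣a) })

  ⇒coprime-*ˡ : ∀ {m n a} → Coprime m a → Coprime n a → Coprime (m * n) a
  ⇒coprime-*ˡ cm cn = coprime-sym (coprime-*ʳ (coprime-sym cm) (coprime-sym cn))

  -- Writing x ∈ [0, m n) as t m + y, the m-part depends only on y and, for fixed y,
  -- t ↦ (t m + y) mod n permutes [0, n).
  Ψ-multiplicative : ∀ k m n a → .{{NonZero n}} → Coprime m n → Ψ k (m * n) a ≡ Ψ k m a * Ψ k n a
  Ψ-multiplicative zero m n a cop with gcd a m ≟ 1 | gcd a n ≟ 1
  ... | yes e₁ | yes e₂ = 𝟙-yes _ (coprime′⇒gcd≡1 a (m * n) (⇒coprime-*ˡ (gcd≡1⇒coprime′ a m e₁) (gcd≡1⇒coprime′ a n e₂)))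
  ... | no ¬e₁ | _      = 𝟙-no _ (λ e → ¬e₁ (coprime′⇒gcd≡1 a m (proj₁ (coprime-*ˡ⇒ (gcd≡1⇒coprime′ a (m * n) e)))))
  ... | yes _  | no ¬e₂ = 𝟙-no _ (λ e → ¬e₂ (coprime′⇒gcd≡1 a n (proj₂ (coprime-*ˡ⇒ {m} (gcd≡1⇒coprime′ a (m * n) e)))))
  Ψ-multiplicative (suc k) m n a cop = begin
      ∑ (m * n) (λ x → Ψ k (m * n) (a + x * x))
    ≡⟨ ∑-ext (m * n) (λ x → Ψ-multiplicative k m n (a + x * x) cop) ⟩
      ∑ (m * n) (λ x → f x * g x)
    ≡⟨ cong (λ z → ∑ z (λ x → f x * g x)) (*-comm m n) ⟩
      ∑ (n * m) (λ x → f x * g x)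
    ≡⟨ ∑-block n m (λ x → f x * g x) ⟩
      ∑ n (λ t → ∑ m (λ y → f (t * m + y) * g (t * m + y)))
    ≡⟨ ∑-ext n (λ t → ∑-ext m (λ y → cong (_* g (t * m + y)) (Ψ-periodic k m a t y))) ⟩
      ∑ n (λ t → ∑ m (λ y → f y * g (t * m + y)))
    ≡⟨ ∑-swap n m (λ t y → f y * g (t * m + y)) ⟩
      ∑ m (λ y → ∑ n (λ t → f y * g (t * m + y)))
    ≡⟨ ∑-ext m (λ y → trans (∑-*ˡ n (f y) _) (cong (f y *_) (fibreSum y))) ⟩
      ∑ m (λ y → f y * ∑ n g)
    ≡⟨ ∑-*ʳ m (∑ n g) f ⟩
      ∑ m f * ∑ n g ∎
    where
    open ≡-Reasoning
    f g : ℕ → ℕ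
    f x = Ψ k m (a + x * x)
    g x = Ψ k n (a + x * x)
    fibreSum : ∀ y → ∑ n (λ t → g (t * m + y)) ≡ ∑ n g
    fibreSum y = trans
      (∑-ext n (λ t → Ψ-mod k n _ _ (mod-+ˡ a (mod-* (mod-sym (mod-% (t * m + y))) (mod-sym (mod-% (t * m + y)))))))
      (∑-perm n (λ t → (t * m + y) % n) g (λ t _ → m%n<n _ n) (%-affine-injective y (coprime-sym cop)))

  -- Lifting by a prime already dividing the modulus: Ψ k (p n) a = pᵏ Ψ k n a for p ∣ n,
  -- since p n and n have the same units and x ↦ Ψ k n (a + x²) is n-periodic.
  Ψ-lift : ∀ k p n a → p ∣ n → Ψ k (p * n) a ≡ p ^ k * Ψ k n a
  Ψ-lift zero p n a p∣n =
    trans (𝟙-cong (λ e → coprime′⇒gcd≡1 a n (proj₂ (coprime-*ˡ⇒ {p} (gcd≡1⇒coprime′ a (p * n) e))))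
                  (λ e → coprime′⇒gcd≡1 a (p * n) (λ { (d∣pn , d∣a) →
                           ⇒coprime-*ˡ (gcd≡1⇒coprime′ a n e) (gcd≡1⇒coprime′ a n e)
                             (∣-trans d∣pn (*-monoˡ-∣ n p∣n) , d∣a) })) _ _)
          (sym (+-identityʳ _))
  Ψ-lift (suc k) p n a p∣n = begin
      ∑ (p * n) (λ x → Ψ k (p * n) (a + x * x))
    ≡⟨ ∑-ext (p * n) (λ x → Ψ-lift k p n (a + x * x) p∣n) ⟩
      ∑ (p * n) (λ x → p ^ k * Ψ k n (a + x * x))
    ≡⟨ ∑-*ˡ (p * n) (p ^ k) _ ⟩
      p ^ k * ∑ (p * n) (λ x → Ψ k n (a + x * x))
    ≡⟨ cong (p ^ k *_) (∑-periodic p n _ (Ψ-periodic k n a)) ⟩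
      p ^ k * (p * ∑ n (λ x → Ψ k n (a + x * x)))
    ≡⟨ rearrange (p ^ k) p _ ⟩
      p * p ^ k * ∑ n (λ x → Ψ k n (a + x * x)) ∎
    where
    open ≡-Reasoning
    rearrange : ∀ a b c → a * (b * c) ≡ b * a * c
    rearrange = solve-∀

  Ψ-one : ∀ k a → Ψ k 1 a ≡ 1
  Ψ-one zero    a = 𝟙-yes (gcd a 1 ≟ 1) (gcd-zeroʳ a)
  Ψ-one (suc k) a = cong (_+ 0) (Ψ-one k (a + 0 * 0))

  -- Modulo 2: of the two choices for the last coordinate exactly one makes the sum odd.
  Ψ-two : ∀ k a → Ψ (suc k) 2 a ≡ 2 ^ k
  Ψ-two zero    a = trans (Ψ-mod 1 2 a (a % 2) (mod-sym (mod-% a))) (byResidue (a % 2) (m%n<n a 2))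
    where
    byResidue : ∀ r → r < 2 → Ψ 1 2 r ≡ 1
    byResidue 0 _ = refl
    byResidue 1 _ = refl
    byResidue (suc (suc r)) (s≤s (s≤s ()))
  Ψ-two (suc k) a = cong₂ _+_ (Ψ-two k (a + 0)) (cong (_+ 0) (Ψ-two k (a + 1)))

module OddPrime (t : ℕ) (prime : Prime (3 + 2 * t)) where

  open import Data.Nat
  open import Data.Nat.Properties
  open import Data.Nat.DivMod using (_%_; m%n<n)
  open import Data.Nat.Divisibility
  open import Data.Nat.Primality using (euclidsLemma; prime⇒irreducible)
  open import Data.Nat.Coprimality using (Coprime)
  open import Data.Product using (_,_)
  open import Data.Sum using (_⊎_; inj₁; inj₂)
  open import Data.Empty using (⊥-elim)
  open import Relation.Nullary using (yes; no; ¬_)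
  open import Relation.Binary.PropositionalEquality
  open import Data.Nat.Tactic.RingSolver using (solve-∀)
  open FiniteSum
  open Congruence
  open Counting

  -- p is kept opaque so that normalisation never unfolds it into 3 + 2t.
  opaque
    p : ℕ
    p = 3 + 2 * t

    p≡ : p ≡ 3 + 2 * t
    p≡ = refl

  instance
    p-nonZero : NonZero p
    p-nonZero = ≢-nonZero (λ e → 0≢1+n (sym (trans (sym p≡) e)))

  p-prime : Prime p
  p-prime = subst Prime (sym p≡) prime

  -- p − 1 = 2 + 2t, which is ≡ −1 (mod p).
  q : ℕ
  q = 2 + 2 * t

  q<p : q < p
  q<p = subst (q <_) (sym p≡) (n<1+n q)

  0<p : 0 < p
  0<p = subst (0 <_) (sym p≡) z<s

  suc<p : ∀ {i} → i < q → suc i < p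
  suc<p i<q = subst (suc _ <_) (sym p≡) (s≤s i<q)

  p-odd : p ≡ suc (2 * (1 + t))
  p-odd = trans p≡ (l t)
    where
    l : ∀ t → 3 + 2 * t ≡ suc (2 * (1 + t))
    l = solve-∀

  ∑-p : ∀ f → ∑ p f ≡ f 0 + ∑ q (λ i → f (suc i))
  ∑-p f = cong (λ z → ∑ z f) p≡

  p∤⇒coprime : ∀ {a} → ¬ p ∣ a → Coprime p a
  p∤⇒coprime {a} p∤a {d} (d∣p , d∣a) with prime⇒irreducible p-prime d∣p
  ... | inj₁ d≡1 = d≡1
  ... | inj₂ refl = ⊥-elim (p∤a d∣a)

  p∣⇒¬coprime : ∀ {a} → p ∣ a → ¬ Coprime p a
  p∣⇒¬coprime p∣a c with trans (sym p≡) (c (∣-refl , p∣a))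
  ... | ()

  p∤nonzero : ∀ {x} → x < p → x ≢ 0 → ¬ p ∣ x
  p∤nonzero x<p x≢0 p∣x = x≢0 (∣-small p∣x x<p)

  p∤q : ¬ p ∣ q
  p∤q = p∤nonzero q<p (λ ())

  p∤1 : ¬ p ∣ 1
  p∤1 = p∤nonzero (suc<p {0} z<s) (λ ())

  p∣square : ∀ {x} → p ∣ x * x → p ∣ x
  p∣square {x} p∣x² with euclidsLemma x x p-prime p∣x²
  ... | inj₁ p∣x = p∣x
  ... | inj₂ p∣x = p∣x

  unit-cancel : ∀ {c y y'} → ¬ p ∣ c → (c * y) % p ≡ (c * y') % p → y ≡[ p ] y'
  unit-cancel {c} {y} {y'} p∤c e =
    mod-cancel (p∤⇒coprime p∤c) (subst₂ (λ u v → u ≡[ p ] v) (*-comm c y) (*-comm c y') (%-mod e))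

  unit-scale-injective : ∀ {c} → ¬ p ∣ c → ∀ y y' → y < p → y' < p → (c * y) % p ≡ (c * y') % p → y ≡ y'
  unit-scale-injective p∤c y y' y<p y'<p e = mod-small y<p y'<p (unit-cancel p∤c e)

  N : ℕ → ℕ → ℕ
  N zero    a = 𝟙 (p ∣? a)
  N (suc k) a = ∑ p (λ x → N k (a + x * x))

  N-mod : ∀ k a b → a ≡[ p ] b → N k a ≡ N k b
  N-mod zero    a b a≡b = 𝟙-cong (mod-∣ ∣-refl (mod-sym a≡b)) (mod-∣ ∣-refl a≡b) _ _
  N-mod (suc k) a b a≡b = ∑-ext p (λ x → N-mod k _ _ (mod-+ʳ (x * x) a≡b))

  Ψ+N : ∀ k a → Ψ k p a + N k a ≡ p ^ k
  Ψ+N zero a with p ∣? a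
  ... | yes p∣a = cong (_+ 1) (𝟙-no _ (λ e → p∣⇒¬coprime p∣a (gcd≡1⇒coprime′ a p e)))
  ... | no p∤a  = cong (_+ 0) (𝟙-yes _ (coprime′⇒gcd≡1 a p (p∤⇒coprime p∤a)))
  Ψ+N (suc k) a =
    trans (sym (∑-+ p (λ x → Ψ k p (a + x * x)) (λ x → N k (a + x * x))))
          (trans (∑-ext p (λ x → Ψ+N k (a + x * x))) (∑-const p (p ^ k)))

  -- Summing N k over all shifts a counts every tuple once.
  N-total : ∀ k s → ∑ p (λ a → N k (a + s)) ≡ p ^ k
  N-total zero s = begin
      ∑ p (λ a → 𝟙 (p ∣? (a + s)))
    ≡⟨ ∑-ext p (λ a → 𝟙-cong (mod-∣ ∣-refl (mod-% (a + s))) (mod-∣ ∣-refl (mod-sym (mod-% (a + s)))) _ _) ⟩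
      ∑ p (λ a → 𝟙 (p ∣? ((a + s) % p)))
    ≡⟨ ∑-perm p (λ a → (a + s) % p) (λ z → 𝟙 (p ∣? z)) (λ a _ → m%n<n (a + s) p)
         (λ a a' a<p a'<p e → mod-small a<p a'<p (mod-+cancelʳ s (%-mod e))) ⟩
      ∑ p (λ z → 𝟙 (p ∣? z))
    ≡⟨ ∑-cong p (λ z z<p → trans (𝟙-cong (λ p∣z → ∣-small p∣z z<p) (λ { refl → p ∣0 }) (p ∣? z) (z ≟ 0))
                                   (sym (*-identityʳ _))) ⟩
      ∑ p (λ z → 𝟙 (z ≟ 0) * 1)
    ≡⟨ ∑-point p 0 0<p ⟩
      1 ∎
    where open ≡-Reasoning
  N-total (suc k) s = begin
      ∑ p (λ a → ∑ p (λ x → N k ((a + s) + x * x)))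
    ≡⟨ ∑-swap p p (λ a x → N k ((a + s) + x * x)) ⟩
      ∑ p (λ x → ∑ p (λ a → N k ((a + s) + x * x)))
    ≡⟨ ∑-ext p (λ x → trans (∑-ext p (λ a → cong (N k) (+-assoc a s (x * x)))) (N-total k (s + x * x))) ⟩
      ∑ p (λ x → p ^ k)
    ≡⟨ ∑-const p (p ^ k) ⟩
      p * p ^ k ∎
    where open ≡-Reasoning

  square-difference : ∀ x y → x ≤ y → y * y ∸ x * x ≡ (y ∸ x) * (y + x)
  square-difference x y x≤y = begin
      y * y ∸ x * x             ≡⟨ cong (λ z → z * z ∸ x * x) (sym e) ⟩
      (x + d) * (x + d) ∸ x * x ≡⟨ cong (_∸ x * x) (expand x d) ⟩
      x * x + d * ((x + d) + x) ∸ x * x ≡⟨ m+n∸m≡n (x * x) _ ⟩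
      d * ((x + d) + x)         ≡⟨ cong (λ z → d * (z + x)) e ⟩
      d * (y + x)               ∎
    where
    open ≡-Reasoning
    d = y ∸ x
    e : x + d ≡ y
    e = m+[n∸m]≡n x≤y
    expand : ∀ x d → (x + d) * (x + d) ≡ x * x + d * ((x + d) + x)
    expand = solve-∀

  multiple-below-2p : ∀ {s} → p ∣ s → s < p + p → s ≡ 0 ⊎ s ≡ p
  multiple-below-2p (divides zero e)          _    = inj₁ e
  multiple-below-2p (divides (suc zero) e)    _    = inj₂ (trans e (+-identityʳ p))
  multiple-below-2p (divides (suc (suc k)) e) s<2p =
    ⊥-elim (<⇒≱ s<2p (≤-trans (+-monoʳ-≤ p (m≤m+n p (k * p))) (≤-reflexive (sym e))))

  squares-congruent≤ : ∀ {x y} → x ≤ y → y < p → x * x ≡[ p ] y * y → x ≡ y ⊎ x + y ≡ p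
  squares-congruent≤ {x} {y} x≤y y<p h
    with euclidsLemma (y ∸ x) (y + x) p-prime (subst (p ∣_) (square-difference x y x≤y) (mod-∸ (*-mono-≤ x≤y x≤y) h))
  ... | inj₁ p∣y-x = inj₁ (sym (trans (sym (m+[n∸m]≡n x≤y))
                            (trans (cong (x +_) (∣-small p∣y-x (≤-<-trans (m∸n≤m y x) y<p))) (+-identityʳ x))))
  ... | inj₂ p∣y+x with multiple-below-2p p∣y+x (+-mono-< y<p (≤-<-trans x≤y y<p))
  ...   | inj₂ y+x≡p = inj₂ (trans (+-comm x y) y+x≡p)
  ...   | inj₁ y+x≡0 = inj₁ (trans (m+n≡0⇒n≡0 y y+x≡0) (sym (m+n≡0⇒m≡0 y y+x≡0)))

  squares-congruent : ∀ {x y} → x < p → y < p → x * x ≡[ p ] y * y → x ≡ y ⊎ x + y ≡ p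
  squares-congruent {x} {y} x<p y<p h with ≤-total x y
  ... | inj₁ x≤y = squares-congruent≤ x≤y y<p h
  ... | inj₂ y≤x with squares-congruent≤ y≤x x<p (mod-sym h)
  ...   | inj₁ y≡x   = inj₁ (sym y≡x)
  ...   | inj₂ y+x≡p = inj₂ (trans (+-comm x y) y+x≡p)

  square-negate : ∀ x x' → x + x' ≡ p → x * x ≡[ p ] x' * x'
  square-negate x x' e = x' , x , subst (λ P → x * x + x' * P ≡ x' * x' + x * P) e (l x x')
    where
    l : ∀ x x' → x * x + x' * (x + x') ≡ x' * x' + x * (x + x')
    l = solve-∀

  N1-0 : N 1 0 ≡ 1
  N1-0 = trans (∑-cong p (λ x x<p → trans (𝟙-cong (λ p∣x² → ∣-small (p∣square p∣x²) x<p) (λ { refl → p ∣0 })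
                                                   (p ∣? (0 + x * x)) (x ≟ 0))
                                           (sym (*-identityʳ _))))
               (∑-point p 0 0<p)

  N1-two-roots : ∀ a → ¬ p ∣ a → ∀ x₀ → x₀ < p → p ∣ a + x₀ * x₀ → N 1 a ≡ 2
  N1-two-roots a p∤a x₀ x₀<p root₀ =
    trans (∑-cong p roots)
          (trans (∑-+ p (λ x → 𝟙 (x ≟ x₀) * 1) (λ x → 𝟙 (x ≟ x₁) * 1))
                 (cong₂ _+_ (∑-point p x₀ x₀<p) (∑-point p x₁ x₁<p)))
    where
    x₁ = p ∸ x₀
    x₀+x₁ : x₀ + x₁ ≡ p
    x₀+x₁ = m+[n∸m]≡n (<⇒≤ x₀<p)
    x₀≢0 : x₀ ≢ 0
    x₀≢0 refl = p∤a (subst (p ∣_) (+-identityʳ a) root₀)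
    x₁<p : x₁ < p
    x₁<p = ∸-monoʳ-< (n≢0⇒n>0 x₀≢0) (<⇒≤ x₀<p)
    x₁≢x₀ : x₁ ≢ x₀
    x₁≢x₀ eq = even≢odd x₀ (1 + t) (trans (cong (x₀ +_) (trans (+-identityʳ x₀) (sym eq))) (trans x₀+x₁ p-odd))
    root₁ : p ∣ a + x₁ * x₁
    root₁ = mod-0⇒∣ (mod-trans (mod-+ˡ a (mod-sym (square-negate x₀ x₁ x₀+x₁))) (∣⇒mod-0 root₀))
    roots : ∀ x → x < p → 𝟙 (p ∣? (a + x * x)) ≡ 𝟙 (x ≟ x₀) * 1 + 𝟙 (x ≟ x₁) * 1
    roots x x<p with p ∣? (a + x * x)
    ... | no ¬root = sym (cong₂ _+_ (cong (_* 1) (𝟙-no (x ≟ x₀) λ { refl → ¬root root₀ }))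
                                    (cong (_* 1) (𝟙-no (x ≟ x₁) λ { refl → ¬root root₁ })))
    ... | yes root = bothRoots (squares-congruent x<p x₀<p x²≡x₀²)
      where
      x²≡x₀² : x * x ≡[ p ] x₀ * x₀
      x²≡x₀² = mod-+cancelˡ {p} {x * x} {x₀ * x₀} a
                 (mod-trans {p} {a + x * x} {0} {a + x₀ * x₀} (∣⇒mod-0 root) (mod-sym (∣⇒mod-0 root₀)))
      bothRoots : x ≡ x₀ ⊎ x + x₀ ≡ p → 1 ≡ 𝟙 (x ≟ x₀) * 1 + 𝟙 (x ≟ x₁) * 1
      bothRoots (inj₁ x≡x₀) = sym (cong₂ _+_ (cong (_* 1) (𝟙-yes (x ≟ x₀) x≡x₀))
                                             (cong (_* 1) (𝟙-no (x ≟ x₁) (λ x≡x₁ → x₁≢x₀ (trans (sym x≡x₁) x≡x₀)))))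
      bothRoots (inj₂ x+x₀≡p) = sym (cong₂ _+_ (cong (_* 1) (𝟙-no (x ≟ x₀) (λ x≡x₀ → x₁≢x₀ (trans (sym x≡x₁) x≡x₀))))
                                               (cong (_* 1) (𝟙-yes (x ≟ x₁) x≡x₁)))
        where
        x≡x₁ : x ≡ x₁
        x≡x₁ = trans (sym (m+n∸n≡m x x₀)) (cong (_∸ x₀) x+x₀≡p)

  N1-0or2 : ∀ a → ¬ p ∣ a → N 1 a ≡ 0 ⊎ N 1 a ≡ 2
  N1-0or2 a p∤a with N 1 a ≟ 0
  ... | yes N≡0 = inj₁ N≡0
  ... | no N≢0 with ∑-nonzero p _ N≢0
  ...   | x₀ , x₀<p , term≢0 = inj₂ (N1-two-roots a p∤a x₀ x₀<p (𝟙≢0 (p ∣? (a + x₀ * x₀)) term≢0))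

  -- N 1 is invariant under scaling by a nonzero square: y ↦ x y permutes the roots.
  N1-scale : ∀ x → ¬ p ∣ x → N 1 (x * x) ≡ N 1 1
  N1-scale x p∤x = sym (trans (∑-ext p same)
                              (∑-perm p scale g (λ y _ → m%n<n (x * y) p) (unit-scale-injective p∤x)))
    where
    scale g : ℕ → ℕ
    scale y = (x * y) % p
    g z = 𝟙 (p ∣? (x * x + z * z))
    expand-scaled : ∀ x y → x * x + (x * y) * (x * y) ≡ (x * x) * (1 + y * y)
    expand-scaled = solve-∀
    scaled : ∀ y → x * x + scale y * scale y ≡[ p ] (x * x) * (1 + y * y)
    scaled y = mod-trans (mod-+ˡ (x * x) (mod-* (mod-% (x * y)) (mod-% (x * y)))) (mod-≡ (expand-scaled x y))
    cancel : ∀ y → p ∣ x * x ⊎ p ∣ 1 + y * y → p ∣ 1 + y * y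
    cancel y (inj₁ p∣x²) = ⊥-elim (p∤x (p∣square p∣x²))
    cancel y (inj₂ p∣1+y²) = p∣1+y²
    same : ∀ y → 𝟙 (p ∣? (1 + y * y)) ≡ g (scale y)
    same y = 𝟙-cong (λ d → mod-∣ ∣-refl (scaled y) (∣n⇒∣m*n (x * x) d))
                    (λ d → cancel y (euclidsLemma (x * x) (1 + y * y) p-prime (mod-∣ ∣-refl (mod-sym (scaled y)) d))) _ _

  -- N 2 0 = 1 + (p − 1) N 1 1: the term x = 0 and the p − 1 nonzero squares.
  N2-0 : N 2 0 ≡ 1 + q * N 1 1
  N2-0 = trans (∑-p (λ x → N 1 (0 + x * x)))
               (cong₂ _+_ N1-0 (trans (∑-cong q (λ i i<q → N1-scale (suc i) (p∤nonzero (suc<p i<q) (λ ()))))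
                                      (∑-const q (N 1 1))))

-- Modulo an odd prime p every residue is a sum of two squares, and consequently
-- N 2 a (the number of solutions of a + x² + y² ≡ 0) is the same for all units a.
module TwoSquares (t : ℕ) (prime : Prime (3 + 2 * t)) where

  open import Data.Nat
  open import Data.Nat.Properties
  open import Data.Nat.DivMod
  open import Data.Nat.Divisibility
  open import Data.Product using (Σ; _×_; _,_)
  open import Data.Sum using (inj₁; inj₂)
  open import Relation.Nullary using (¬_)
  open import Relation.Binary.PropositionalEquality
  open import Data.Nat.Tactic.RingSolver using (solve-∀)
  open FiniteSum
  open Congruence
  open OddPrime t prime

  -- Pairs (x, y) ∈ [0, p)² are encoded as x p + y ∈ [0, p²).
  pair-/ : ∀ x y → y < p → (x * p + y) / p ≡ x
  pair-/ x y y<p =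
    trans (+-distrib-/ (x * p) y (subst (_< p) (sym (cong₂ _+_ (m*n%n≡0 x p) (m<n⇒m%n≡m y<p))) y<p))
          (trans (cong₂ _+_ (m*n/n≡m x p) (m<n⇒m/n≡0 y<p)) (+-identityʳ x))

  pair-% : ∀ x y → y < p → (x * p + y) % p ≡ y
  pair-% x y y<p = trans (cong (_% p) (+-comm (x * p) y)) (trans ([m+kn]%n≡m%n y x p) (m<n⇒m%n≡m y<p))

  pair-decompose : ∀ i → (i / p) * p + i % p ≡ i
  pair-decompose i = trans (+-comm _ (i % p)) (sym (m≡m%n+[m/n]*n i p))

  pair< : ∀ x y → x < p → y < p → x * p + y < p * p
  pair< x y x<p y<p = ≤-trans (+-monoʳ-< (x * p) y<p) (subst (_≤ p * p) (+-comm p (x * p)) (*-monoˡ-≤ p x<p))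

  solves : ℕ → ℕ → ℕ → ℕ
  solves a x y = 𝟙 (p ∣? ((a + x * x) + y * y))

  N2-pairs : ∀ a → N 2 a ≡ ∑ (p * p) (λ i → solves a (i / p) (i % p))
  N2-pairs a = sym (trans (∑-block p p _)
                          (∑-ext p (λ x → ∑-cong p (λ y y<p → cong₂ (solves a) (pair-/ x y y<p) (pair-% x y y<p)))))

  p-as-q : ∀ A K → A + K * (3 + 2 * t) ≡ A + K * p
  p-as-q A K = cong (λ P → A + K * P) (sym p≡)

  -- Multiplication of (x + i y) by (u + i v) in 𝔽_p[i], i² = −1 ≡ q, as a map on encoded pairs.
  -- The two-square identity shows it maps solutions for a to solutions for a (u² + v²),
  -- and it is injective when u² + v² is a unit.
  module Rotation (u v : ℕ) where

    X Y : ℕ → ℕ → ℕ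
    X x y = x * u + q * (y * v)
    Y x y = x * v + y * u

    rotate : ℕ → ℕ
    rotate i = (X (i / p) (i % p) % p) * p + Y (i / p) (i % p) % p

    rotate< : ∀ i → rotate i < p * p
    rotate< i = pair< _ _ (m%n<n (X (i / p) (i % p)) p) (m%n<n (Y (i / p) (i % p)) p)

    two-squares : ∀ x y u v t →
      (x * u + (2 + 2 * t) * (y * v)) * (x * u + (2 + 2 * t) * (y * v)) + (x * v + y * u) * (x * v + y * u)
        ≡ (x * x + y * y) * (u * u + v * v) + (2 * x * u * y * v + (1 + 2 * t) * (y * y * (v * v))) * (3 + 2 * t)
    two-squares = solve-∀

    rotate-norm : ∀ a x y → (a * (u * u + v * v) + X x y % p * (X x y % p)) + Y x y % p * (Y x y % p)
                            ≡[ p ] ((a + x * x) + y * y) * (u * u + v * v)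
    rotate-norm a x y =
      mod-trans (mod-≡ (+-assoc (a * c) (X′ * X′) (Y′ * Y′)))
      (mod-trans (mod-+ˡ (a * c) (mod-+ (mod-* (mod-% (X x y)) (mod-% (X x y))) (mod-* (mod-% (Y x y)) (mod-% (Y x y)))))
      (mod-trans (mod-+ˡ (a * c) (subst (_≡[ p ] ((x * x + y * y) * c))
                                    (sym (trans (two-squares x y u v t) (p-as-q ((x * x + y * y) * c) K)))
                                    (mod-multiple ((x * x + y * y) * c) K)))
                 (mod-≡ (sym (distrib a x y c)))))
      where
      c  = u * u + v * v
      X′ = X x y % p
      Y′ = Y x y % p
      K  = 2 * x * u * y * v + (1 + 2 * t) * (y * y * (v * v))
      distrib : ∀ a x y c → (a + x * x + y * y) * c ≡ a * c + (x * x + y * y) * c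
      distrib = solve-∀

    -- Multiplying back by the conjugate u − i v recovers x (u² + v²) and y (u² + v²).
    conjugate-x : ∀ x y u v t →
      (x * u + (2 + 2 * t) * (y * v)) * u + (x * v + y * u) * v ≡ x * (u * u + v * v) + (y * u * v) * (3 + 2 * t)
    conjugate-x = solve-∀

    conjugate-y : ∀ x y u v t →
      (x * v + y * u) * u + (x * u + (2 + 2 * t) * (y * v)) * (2 + 2 * t) * v
        ≡ y * (u * u + v * v) + (x * u * v + (1 + 2 * t) * (y * v * v)) * (3 + 2 * t)
    conjugate-y = solve-∀

    unrotate : ∀ {x y x' y'} → X x y ≡[ p ] X x' y' → Y x y ≡[ p ] Y x' y' →
               x * (u * u + v * v) ≡[ p ] x' * (u * u + v * v) × y * (u * u + v * v) ≡[ p ] y' * (u * u + v * v)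
    unrotate {x} {y} {x'} {y'} eX eY =
      mod-trans (mod-sym (mod-multiple _ (y * u * v)))
        (mod-trans (mod-≡ (sym (trans (conjugate-x x y u v t) (p-as-q _ (y * u * v)))))
        (mod-trans (mod-+ (mod-*ʳ u eX) (mod-*ʳ v eY))
        (mod-trans (mod-≡ (trans (conjugate-x x' y' u v t) (p-as-q _ (y' * u * v)))) (mod-multiple _ (y' * u * v)))))
      , mod-trans (mod-sym (mod-multiple _ (Ky x y)))
        (mod-trans (mod-≡ (sym (trans (conjugate-y x y u v t) (p-as-q _ (Ky x y)))))
        (mod-trans (mod-+ (mod-*ʳ u eY) (mod-*ʳ v (mod-*ʳ q eX)))
        (mod-trans (mod-≡ (trans (conjugate-y x' y' u v t) (p-as-q _ (Ky x' y')))) (mod-multiple _ (Ky x' y')))))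
      where
      Ky : ℕ → ℕ → ℕ
      Ky x y = x * u * v + (1 + 2 * t) * (y * v * v)

    rotate-injective : ¬ p ∣ u * u + v * v → ∀ i i' → i < p * p → i' < p * p → rotate i ≡ rotate i' → i ≡ i'
    rotate-injective p∤c i i' i< i'< e = recover (unrotate {x} {y} {x'} {y'} eX eY)
      where
      x = i / p ; y = i % p ; x' = i' / p ; y' = i' % p
      c = u * u + v * v
      eX : X x y ≡[ p ] X x' y'
      eX = %-mod (trans (sym (pair-/ (X x y % p) (Y x y % p) (m%n<n (Y x y) p)))
                 (trans (cong (_/ p) e) (pair-/ (X x' y' % p) (Y x' y' % p) (m%n<n (Y x' y') p))))
      eY : Y x y ≡[ p ] Y x' y'
      eY = %-mod (trans (sym (pair-% (X x y % p) (Y x y % p) (m%n<n (Y x y) p)))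
                 (trans (cong (_% p) e) (pair-% (X x' y' % p) (Y x' y' % p) (m%n<n (Y x' y') p))))
      recover : x * c ≡[ p ] x' * c × y * c ≡[ p ] y' * c → i ≡ i'
      recover (ex , ey) = trans (sym (pair-decompose i)) (trans (cong₂ (λ a b → a * p + b) x≡x' y≡y') (pair-decompose i'))
        where
        x≡x' : x ≡ x'
        x≡x' = mod-small (m<n*o⇒m/o<n i<) (m<n*o⇒m/o<n i'<) (mod-cancel (p∤⇒coprime p∤c) ex)
        y≡y' : y ≡ y'
        y≡y' = mod-small (m%n<n i p) (m%n<n i' p) (mod-cancel (p∤⇒coprime p∤c) ey)

  N2-scale≤ : ∀ a c u v → (u * u + v * v) ≡[ p ] c → ¬ p ∣ c → N 2 a ≤ N 2 (a * c)
  N2-scale≤ a c u v c≡u²+v² p∤c =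
    subst₂ _≤_ (sym (N2-pairs a)) (sym (N2-pairs (a * c)))
      (∑-inj≤ (p * p) (p * p) rotate W V (λ i _ → rotate< i) (λ i _ → 𝟙≤1 _) (λ j _ → 𝟙≤1 _) preserves
              (λ i i' i< i'< _ _ → rotate-injective p∤u²+v² i i' i< i'<))
    where
    open Rotation u v
    W V : ℕ → ℕ
    W i = solves a (i / p) (i % p)
    V j = solves (a * c) (j / p) (j % p)
    p∤u²+v² : ¬ p ∣ u * u + v * v
    p∤u²+v² d = p∤c (mod-∣ ∣-refl (mod-sym c≡u²+v²) d)
    preserves : ∀ i → i < p * p → W i ≡ 1 → V (rotate i) ≡ 1
    preserves i _ Wi≡1 =
      trans (cong₂ (solves (a * c)) (pair-/ X′ Y′ (m%n<n (Y x y) p)) (pair-% X′ Y′ (m%n<n (Y x y) p)))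
            (𝟙-yes (p ∣? ((a * c + X′ * X′) + Y′ * Y′))
                   (mod-∣ ∣-refl norm
                          (∣m⇒∣m*n c (𝟙≢0 (p ∣? ((a + x * x) + y * y)) (λ e → 0≢1+n (trans (sym e) Wi≡1))))))
      where
      x = i / p ; y = i % p
      X′ = X x y % p ; Y′ = Y x y % p
      norm : (a * c + X′ * X′) + Y′ * Y′ ≡[ p ] ((a + x * x) + y * y) * c
      norm = mod-trans {p} {(a * c + X′ * X′) + Y′ * Y′} {(a * (u * u + v * v) + X′ * X′) + Y′ * Y′}
               (mod-+ʳ (Y′ * Y′) (mod-+ʳ (X′ * X′) (mod-*ˡ a (mod-sym c≡u²+v²))))
               (mod-trans (rotate-norm a x y) (mod-*ˡ ((a + x * x) + y * y) c≡u²+v²))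

  hasRoot : ℕ → ℕ
  hasRoot a = 𝟙 (1 ≤? N 1 a)

  noRoot : ∀ a → N 1 a ≡ 0 → hasRoot a ≡ 0
  noRoot a N≡0 = 𝟙-no (1 ≤? N 1 a) (λ 1≤N → 0≢1+n (sym (n≤0⇒n≡0 (subst (1 ≤_) N≡0 1≤N))))

  hasRoot⇒root : ∀ a → hasRoot a ≡ 1 → Σ ℕ λ x → p ∣ a + x * x
  hasRoot⇒root a e with ∑-nonzero p (λ x → N 0 (a + x * x)) (λ N≡0 → 0≢1+n (trans (sym (noRoot a N≡0)) e))
  ... | x , _ , term≢0 = x , 𝟙≢0 (p ∣? (a + x * x)) term≢0

  N1≡2hasRoot : ∀ a → ¬ p ∣ a → N 1 a ≡ 2 * hasRoot a
  N1≡2hasRoot a p∤a with N1-0or2 a p∤a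
  ... | inj₁ N≡0 = trans N≡0 (sym (cong (2 *_) (noRoot a N≡0)))
  ... | inj₂ N≡2 = trans N≡2 (sym (cong (2 *_) (𝟙-yes (1 ≤? N 1 a) (subst (1 ≤_) (sym N≡2) (s≤s z≤n)))))

  hasRoot-count : ∑ p hasRoot ≡ 2 + t
  hasRoot-count = trans (∑-p hasRoot) (cong₂ _+_ (𝟙-yes (1 ≤? N 1 0) (subst (1 ≤_) (sym N1-0) ≤-refl)) nonzeroCount)
    where
    N1-sum : ∑ p (N 1) ≡ p
    N1-sum = trans (∑-ext p (λ a → cong (N 1) (sym (+-identityʳ a)))) (trans (N-total 1 0) (*-identityʳ p))
    doubled : 1 + 2 * ∑ q (λ i → hasRoot (suc i)) ≡ 1 + 2 * (1 + t)
    doubled = trans (cong (1 +_) (sym (∑-*ˡ q 2 (λ i → hasRoot (suc i)))))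
                (trans (cong₂ _+_ (sym N1-0) (sym (∑-cong q (λ i i<q → N1≡2hasRoot (suc i) (p∤nonzero (suc<p i<q) (λ ()))))))
                (trans (sym (∑-p (N 1))) (trans N1-sum (trans p≡ (l t)))))
      where
      l : ∀ t → 3 + 2 * t ≡ 1 + 2 * (1 + t)
      l = solve-∀
    nonzeroCount : ∑ q (λ i → hasRoot (suc i)) ≡ 1 + t
    nonzeroCount = *-cancelˡ-≡ _ _ 2 (+-cancelˡ-≡ 1 _ _ doubled)

  -- Every residue c is a sum of two squares: the (p + 1)/2 residues −x² and the
  -- (p + 1)/2 residues c − y² cannot be disjoint.
  sum-of-two-squares : ∀ c → Σ ℕ λ u → Σ ℕ λ v → (u * u + v * v) ≡[ p ] c
  sum-of-two-squares c =
    fromCommon (pigeonhole p hasRoot (λ a → hasRoot (shift a)) (λ _ _ → 𝟙≤1 _) (λ _ _ → 𝟙≤1 _) overfull)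
    where
    -- shift a ≡ −(c + a), so hasRoot (shift a) says that c + a is a square.
    shift : ℕ → ℕ
    shift a = (q * (c + a)) % p
    shift-count : ∑ p (λ a → hasRoot (shift a)) ≡ ∑ p hasRoot
    shift-count = ∑-perm p shift hasRoot (λ a _ → m%n<n (q * (c + a)) p)
      (λ a a' a<p a'<p e → mod-small a<p a'<p (mod-+cancelˡ {p} {a} {a'} c (unit-cancel {q} {c + a} {c + a'} p∤q e)))
    overfull : p < ∑ p hasRoot + ∑ p (λ a → hasRoot (shift a))
    overfull = subst (p <_) (sym (trans (cong (∑ p hasRoot +_) shift-count) (cong₂ _+_ hasRoot-count hasRoot-count)))
                     (subst (_< (2 + t) + (2 + t)) (sym p≡) (subst (3 + 2 * t <_) (l t) ≤-refl))
      where
      l : ∀ t → 4 + 2 * t ≡ (2 + t) + (2 + t)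
      l = solve-∀
    -- From a + x² ≡ 0 and −(c + a) + y² ≡ 0 (with −1 ≡ q) follows x² + y² ≡ c.
    combine-roots : ∀ a → Σ ℕ (λ x → p ∣ a + x * x) → Σ ℕ (λ y → p ∣ shift a + y * y) →
                    Σ ℕ λ u → Σ ℕ λ v → (u * u + v * v) ≡[ p ] c
    combine-roots a (x , rootA) (y , rootShift) =
      x , y , mod-+cancelʳ {p} {x * x + y * y} {c} (a + b)
                (mod-trans {p} {(x * x + y * y) + (a + b)} {0} {c + (a + b)} sum≡0 (mod-sym c+a+b≡0))
      where
      b = q * (c + a)
      regroup : ∀ x y a b → (x * x + y * y) + (a + b) ≡ (a + x * x) + (b + y * y)
      regroup = solve-∀
      b+y²≡0 : b + y * y ≡[ p ] 0
      b+y²≡0 = mod-trans {p} {b + y * y} {shift a + y * y} {0} (mod-+ʳ (y * y) (mod-sym (mod-% b))) (∣⇒mod-0 rootShift)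
      sum≡0 : (x * x + y * y) + (a + b) ≡[ p ] 0
      sum≡0 = mod-trans {p} {(x * x + y * y) + (a + b)} {(a + x * x) + (b + y * y)} {0} (mod-≡ (regroup x y a b))
                (mod-+ {p} {a + x * x} {0} {b + y * y} {0} (∣⇒mod-0 rootA) b+y²≡0)
      multiple : ∀ c a t → c + (a + (2 + 2 * t) * (c + a)) ≡ 0 + (c + a) * (3 + 2 * t)
      multiple = solve-∀
      c+a+b≡0 : c + (a + b) ≡[ p ] 0
      c+a+b≡0 = mod-trans {p} {c + (a + b)} {0 + (c + a) * p} {0}
                  (mod-≡ (trans (multiple c a t) (p-as-q 0 (c + a)))) (mod-multiple 0 (c + a))
    fromCommon : Σ ℕ (λ a → a < p × hasRoot a ≡ 1 × hasRoot (shift a) ≡ 1) → Σ ℕ λ u → Σ ℕ λ v → (u * u + v * v) ≡[ p ] c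
    fromCommon (a , _ , hasRootA , hasRootShift) = combine-roots a (hasRoot⇒root a hasRootA) (hasRoot⇒root (shift a) hasRootShift)

  unit-divides : ∀ a b → ¬ p ∣ a → Σ ℕ λ c → a * c ≡[ p ] b
  unit-divides a b p∤a =
    fromPreimage (perm-surj p scale (λ c _ → m%n<n (a * c) p) (unit-scale-injective {a} p∤a) (b % p) (m%n<n b p))
    where
    scale : ℕ → ℕ
    scale c = (a * c) % p
    fromPreimage : Σ ℕ (λ c → c < p × scale c ≡ b % p) → Σ ℕ λ c → a * c ≡[ p ] b
    fromPreimage (c , _ , ac≡b) = c , %-mod {p} {a * c} {b} ac≡b

  -- N 2 is constant on units: b = a c with c a unit, and c is a sum of two squares.
  N2-unit≤ : ∀ a b → ¬ p ∣ a → ¬ p ∣ b → N 2 a ≤ N 2 b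
  N2-unit≤ a b p∤a p∤b = viaQuotient (unit-divides a b p∤a)
    where
    viaQuotient : Σ ℕ (λ c → a * c ≡[ p ] b) → N 2 a ≤ N 2 b
    viaQuotient (c , ac≡b) = viaSquares (sum-of-two-squares c)
      where
      p∤c : ¬ p ∣ c
      p∤c p∣c = p∤b (mod-∣ ∣-refl (mod-sym ac≡b) (∣n⇒∣m*n a p∣c))
      viaSquares : (Σ ℕ λ u → Σ ℕ λ v → (u * u + v * v) ≡[ p ] c) → N 2 a ≤ N 2 b
      viaSquares (u , v , c≡u²+v²) = ≤-trans (N2-scale≤ a c u v c≡u²+v² p∤c) (≤-reflexive (N-mod 2 (a * c) b ac≡b))

  N2-unit : ∀ a b → ¬ p ∣ a → ¬ p ∣ b → N 2 a ≡ N 2 b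
  N2-unit a b p∤a p∤b = ≤-antisym (N2-unit≤ a b p∤a p∤b) (N2-unit≤ b a p∤b p∤a)

  -- Counting all p² pairs: N 2 0 + (p − 1) N 2 1 = p², which with N 2 0 = 1 + (p − 1) N 1 1
  -- gives N 1 1 + N 2 1 = p + 1.
  N1+N2 : N 1 1 + N 2 1 ≡ 4 + 2 * t
  N1+N2 = *-cancelˡ-≡ _ _ q (+-cancelˡ-≡ 1 _ _ total)
    where
    total : 1 + q * (N 1 1 + N 2 1) ≡ 1 + q * (4 + 2 * t)
    total = begin
        1 + q * (N 1 1 + N 2 1)
      ≡⟨ distrib t (N 1 1) (N 2 1) ⟩
        (1 + q * N 1 1) + q * N 2 1
      ≡⟨ cong₂ _+_ (sym N2-0) (sym (trans (∑-cong q (λ i i<q → N2-unit (suc i) 1 (p∤nonzero (suc<p i<q) (λ ())) p∤1))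
                                          (∑-const q (N 2 1)))) ⟩
        N 2 0 + ∑ q (λ i → N 2 (suc i))
      ≡⟨ sym (∑-p (N 2)) ⟩
        ∑ p (N 2)
      ≡⟨ trans (∑-ext p (λ a → cong (N 2) (sym (+-identityʳ a)))) (N-total 2 0) ⟩
        p ^ 2
      ≡⟨ trans (cong (λ P → P * (P * 1)) p≡) (square t) ⟩
        1 + q * (4 + 2 * t) ∎
      where
      open ≡-Reasoning
      distrib : ∀ t m n → 1 + (2 + 2 * t) * (m + n) ≡ (1 + (2 + 2 * t) * m) + (2 + 2 * t) * n
      distrib = solve-∀
      square : ∀ t → (3 + 2 * t) * ((3 + 2 * t) * 1) ≡ 1 + (2 + 2 * t) * (4 + 2 * t)
      square = solve-∀

-- N 2 (−1) = ∑ₓ N 1 (x² − 1) is ≡ 0 (mod 4): the terms x = ±1 contribute 1, x = 0 contributes 2,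
-- the other terms are 0 or 2 and come in pairs ±x.  Comparing with N 1 1 + N 2 1 = p + 1 and
-- N 2 1 = N 2 (−1) decides the parity of t.
module MinusOne (t : ℕ) (prime : Prime (3 + 2 * t)) where

  open import Data.Nat
  open import Data.Nat.Properties
  open import Data.Nat.Divisibility
  open import Data.Product using (Σ; _×_; _,_)
  open import Data.Sum using (_⊎_; inj₁; inj₂)
  open import Data.Empty using (⊥)
  open import Relation.Nullary using (¬_)
  open import Relation.Binary.PropositionalEquality
  open import Data.Nat.Tactic.RingSolver using (solve-∀)
  open FiniteSum
  open Congruence
  open OddPrime t prime
  open TwoSquares t prime

  q+1≡p : q + 1 * 1 ≡ p
  q+1≡p = trans (l t) (sym p≡)
    where
    l : ∀ t → (2 + 2 * t) + 1 * 1 ≡ 3 + 2 * t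
    l = solve-∀

  q+1≡0 : q + 1 * 1 ≡[ p ] 0
  q+1≡0 = mod-trans (mod-≡ q+1≡p) mod-self

  -- F x = N 1 (x² − 1), the x-th term of N 2 (−1).
  F : ℕ → ℕ
  F x = N 1 (q + x * x)

  F-negate : ∀ x x' → x + x' ≡ p → F x ≡ F x'
  F-negate x x' e = N-mod 1 (q + x * x) (q + x' * x') (mod-+ˡ q (square-negate x x' e))

  F0 : F 0 ≡ 2
  F0 = N1-two-roots (q + 0 * 0) p∤q′ 1 (suc<p {0} z<s)
         (subst (p ∣_) (trans (sym q+1≡p) (cong (_+ 1 * 1) (sym (+-identityʳ q)))) ∣-refl)
    where
    p∤q′ : ¬ p ∣ (q + 0 * 0)
    p∤q′ d = p∤q (subst (p ∣_) (+-identityʳ q) d)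

  F1 : F 1 ≡ 1
  F1 = trans (N-mod 1 (q + 1 * 1) 0 q+1≡0) N1-0

  -- For 2 ≤ x ≤ p − 2, x² − 1 is a unit, so F x ∈ {0, 2}.
  F-middle : ∀ i → i < t → F (2 + i) ≡ 0 ⊎ F (2 + i) ≡ 2
  F-middle i i<t = N1-0or2 (q + (2 + i) * (2 + i)) unit
    where
    2+i<p : 2 + i < p
    2+i<p = subst (2 + i <_) (sym p≡) (s≤s (s≤s (s≤s (≤-trans (<⇒≤ i<t) (m≤m+n t (t + 0))))))
    not±1 : 2 + i ≡ 1 ⊎ (2 + i) + 1 ≡ p → ⊥
    not±1 (inj₁ ())
    not±1 (inj₂ e) = <⇒≱ i<t (subst (t ≤_) (sym (+-cancelˡ-≡ 3 i (2 * t) (trans (l i) (trans e p≡)))) (m≤m+n t (t + 0)))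
      where
      l : ∀ i → 3 + i ≡ (2 + i) + 1
      l = solve-∀
    unit : ¬ p ∣ (q + (2 + i) * (2 + i))
    unit d = not±1 (squares-congruent 2+i<p (suc<p {0} z<s)
                     (mod-+cancelˡ q (mod-trans (∣⇒mod-0 d) (mod-sym q+1≡0))))

  N2-q≡0mod4 : Σ ℕ λ e → N 2 q ≡ 4 + 4 * e
  N2-q≡0mod4 = fromMiddle (∑-even t (λ i → F (2 + i)) F-middle)
    where
    h = 1 + t
    G : ℕ → ℕ
    G i = F (suc i)
    p≡1+h+h : p ≡ suc (h + h)
    p≡1+h+h = trans p-odd (cong (λ z → suc (h + z)) (+-identityʳ h))
    -- x ↦ p − x maps the upper half of [1, p) onto the lower half.
    reflect : ∀ i → i < h → suc (h + i) + suc (h ∸ suc i) ≡ p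
    reflect i i<h = begin
        suc (h + i) + suc (h ∸ suc i) ≡⟨ cong (suc (h + i) +_) (sym (+-∸-assoc 1 i<h)) ⟩
        suc (h + i) + (h ∸ i)         ≡⟨ cong suc (+-assoc h i (h ∸ i)) ⟩
        suc (h + (i + (h ∸ i)))       ≡⟨ cong (λ z → suc (h + z)) (m+[n∸m]≡n (<⇒≤ i<h)) ⟩
        suc (h + h)                   ≡⟨ sym p≡1+h+h ⟩
        p                             ∎
      where open ≡-Reasoning
    upper≡lower : ∑ h (λ i → G (h + i)) ≡ ∑ h G
    upper≡lower = trans (∑-cong h (λ i i<h → F-negate (suc (h + i)) (suc (h ∸ suc i)) (reflect i i<h)))
                        (∑-perm h (λ i → h ∸ suc i) G (λ i i<h → ∸-monoʳ-< z<s i<h)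
                                (λ i i' i<h i'<h eq → suc-injective (∸-cancelˡ-≡ i<h i'<h eq)))
    halves : N 2 q ≡ F 0 + (∑ h G + ∑ h G)
    halves = trans (cong (λ z → ∑ z F) p≡1+h+h) (cong (F 0 +_) (trans (∑-split h h G) (cong (∑ h G +_) upper≡lower)))
    l : ∀ e → 2 + ((1 + 2 * e) + (1 + 2 * e)) ≡ 4 + 4 * e
    l = solve-∀
    fromMiddle : (Σ ℕ λ e → ∑ t (λ i → F (2 + i)) ≡ 2 * e) → Σ ℕ λ e → N 2 q ≡ 4 + 4 * e
    fromMiddle (e , middle≡2e) =
      e , trans halves (trans (cong₂ _+_ F0 (cong₂ _+_ (cong₂ _+_ F1 middle≡2e) (cong₂ _+_ F1 middle≡2e))) (l e))

  minus-one-square : (N 1 1 ≡ 0 × Σ ℕ λ e → t ≡ 2 * e) ⊎ (N 1 1 ≡ 2 × Σ ℕ λ e → t ≡ 1 + 2 * e)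
  minus-one-square = decide (N1-0or2 1 p∤1) N2-q≡0mod4
    where
    N2-1≡N2-q : N 2 1 ≡ N 2 q
    N2-1≡N2-q = N2-unit 1 q p∤1 p∤q
    l₀ : ∀ e → 4 + 2 * (2 * e) ≡ 0 + (4 + 4 * e)
    l₀ = solve-∀
    l₂ : ∀ e → 4 + 2 * (1 + 2 * e) ≡ 2 + (4 + 4 * e)
    l₂ = solve-∀
    decide : N 1 1 ≡ 0 ⊎ N 1 1 ≡ 2 → (Σ ℕ λ e → N 2 q ≡ 4 + 4 * e) →
             (N 1 1 ≡ 0 × Σ ℕ λ e → t ≡ 2 * e) ⊎ (N 1 1 ≡ 2 × Σ ℕ λ e → t ≡ 1 + 2 * e)
    decide (inj₁ N≡0) (e , N2q≡) = inj₁ (N≡0 , e , sym (*-cancelˡ-≡ (2 * e) t 2 (+-cancelˡ-≡ 4 _ _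
      (trans (l₀ e) (trans (sym (cong₂ _+_ N≡0 (trans N2-1≡N2-q N2q≡))) N1+N2)))))
    decide (inj₂ N≡2) (e , N2q≡) = inj₂ (N≡2 , e , sym (*-cancelˡ-≡ (1 + 2 * e) t 2 (+-cancelˡ-≡ 4 _ _
      (trans (l₂ e) (trans (sym (cong₂ _+_ N≡2 (trans N2-1≡N2-q N2q≡))) N1+N2)))))

-- Since N 2 b only depends on whether p ∣ b, adding two
-- coordinates at a time gives N (2 j) b = A j · [p ∣ b] + B j · [p ∤ b] with a linear
-- recurrence for (A, B) whose matrix has entries N 2 0, N 2 1, Ψ 2 p 0, Ψ 2 p 1.
module Recurrence (t : ℕ) (prime : Prime (3 + 2 * t)) where

  open import Data.Nat
  open import Data.Nat.Properties
  open import Data.Nat.Divisibility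
  open import Relation.Nullary using (Dec; yes; no; ¬_)
  open import Relation.Binary.PropositionalEquality
  open import Data.Nat.Tactic.RingSolver using (solve-∀)
  open FiniteSum
  open Congruence
  open Counting
  open Multiplicative
  open OddPrime t prime
  open TwoSquares t prime

  N0-yes : ∀ b → p ∣ b → N 0 b ≡ 1
  N0-yes b p∣b = 𝟙-yes (p ∣? b) p∣b

  N0-no : ∀ b → ¬ p ∣ b → N 0 b ≡ 0
  N0-no b p∤b = 𝟙-no (p ∣? b) p∤b

  Ψ0-yes : ∀ b → p ∣ b → Ψ 0 p b ≡ 0
  Ψ0-yes b p∣b = +-cancelʳ-≡ (N 0 b) (Ψ 0 p b) 0 (trans (Ψ+N 0 b) (sym (N0-yes b p∣b)))

  Ψ0-no : ∀ b → ¬ p ∣ b → Ψ 0 p b ≡ 1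
  Ψ0-no b p∤b = trans (sym (+-identityʳ (Ψ 0 p b))) (trans (cong (Ψ 0 p b +_) (sym (N0-no b p∤b))) (Ψ+N 0 b))

  two-valued : ∀ (f : ℕ → ℕ) → (∀ b → p ∣ b → f b ≡ f 0) → (∀ b → ¬ p ∣ b → f b ≡ f 1) →
               ∀ b → f b ≡ f 0 * N 0 b + f 1 * Ψ 0 p b
  two-valued f f-div f-unit b = byCase (p ∣? b)
    where
    l₀ : ∀ a b → a * 1 + b * 0 ≡ a
    l₀ = solve-∀
    l₁ : ∀ a b → a * 0 + b * 1 ≡ b
    l₁ = solve-∀
    byCase : Dec (p ∣ b) → f b ≡ f 0 * N 0 b + f 1 * Ψ 0 p b
    byCase (yes p∣b) = trans (f-div b p∣b)
      (sym (trans (cong₂ _+_ (cong (f 0 *_) (N0-yes b p∣b)) (cong (f 1 *_) (Ψ0-yes b p∣b))) (l₀ (f 0) (f 1))))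
    byCase (no p∤b) = trans (f-unit b p∤b)
      (sym (trans (cong₂ _+_ (cong (f 0 *_) (N0-no b p∤b)) (cong (f 1 *_) (Ψ0-no b p∤b))) (l₁ (f 0) (f 1))))

  N2-form : ∀ b → N 2 b ≡ N 2 0 * N 0 b + N 2 1 * Ψ 0 p b
  N2-form = two-valued (N 2) (λ b p∣b → N-mod 2 b 0 (∣⇒mod-0 p∣b)) (λ b p∤b → N2-unit b 1 p∤b p∤1)

  Ψ2-form : ∀ b → Ψ 2 p b ≡ Ψ 2 p 0 * N 0 b + Ψ 2 p 1 * Ψ 0 p b
  Ψ2-form = two-valued (Ψ 2 p) (λ b p∣b → Ψ-mod 2 p b 0 (∣⇒mod-0 p∣b)) unit
    where
    unit : ∀ b → ¬ p ∣ b → Ψ 2 p b ≡ Ψ 2 p 1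
    unit b p∤b = +-cancelʳ-≡ (N 2 b) (Ψ 2 p b) (Ψ 2 p 1)
      (trans (Ψ+N 2 b) (sym (trans (cong (Ψ 2 p 1 +_) (N2-unit b 1 p∤b p∤1)) (Ψ+N 2 1))))

  twice : ℕ → ℕ
  twice zero    = zero
  twice (suc j) = suc (suc (twice j))

  -- The coefficients of N (2 j) = A j · N 0 + B j · Ψ 0 p.
  A B : ℕ → ℕ
  A zero    = 1
  A (suc j) = A j * N 2 0 + B j * Ψ 2 p 0
  B zero    = 0
  B (suc j) = A j * N 2 1 + B j * Ψ 2 p 1

  N-even : ∀ j b → N (twice j) b ≡ A j * N 0 b + B j * Ψ 0 p b
  N-even zero b = l (N 0 b) (Ψ 0 p b)
    where
    l : ∀ x y → x ≡ 1 * x + 0 * y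
    l = solve-∀
  N-even (suc j) b = begin
      ∑ p (λ x → ∑ p (λ y → N (twice j) ((b + x * x) + y * y)))
    ≡⟨ ∑-ext p (λ x → trans (∑-ext p (λ y → N-even j ((b + x * x) + y * y)))
                            (∑-lin p (A j) (B j) (λ y → N 0 ((b + x * x) + y * y)) (λ y → Ψ 0 p ((b + x * x) + y * y)))) ⟩
      ∑ p (λ x → A j * N 1 (b + x * x) + B j * Ψ 1 p (b + x * x))
    ≡⟨ ∑-lin p (A j) (B j) (λ x → N 1 (b + x * x)) (λ x → Ψ 1 p (b + x * x)) ⟩
      A j * N 2 b + B j * Ψ 2 p b
    ≡⟨ cong₂ _+_ (cong (A j *_) (N2-form b)) (cong (B j *_) (Ψ2-form b)) ⟩
      A j * (N 2 0 * N 0 b + N 2 1 * Ψ 0 p b) + B j * (Ψ 2 p 0 * N 0 b + Ψ 2 p 1 * Ψ 0 p b)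
    ≡⟨ l (A j) (B j) (N 2 0) (N 2 1) (Ψ 2 p 0) (Ψ 2 p 1) (N 0 b) (Ψ 0 p b) ⟩
      (A j * N 2 0 + B j * Ψ 2 p 0) * N 0 b + (A j * N 2 1 + B j * Ψ 2 p 1) * Ψ 0 p b ∎
    where
    open ≡-Reasoning
    l : ∀ a b t₀ t₁ u₀ u₁ h g → a * (t₀ * h + t₁ * g) + b * (u₀ * h + u₁ * g) ≡ (a * t₀ + b * u₀) * h + (a * t₁ + b * u₁) * g
    l = solve-∀

  N-even-0 : ∀ j → N (twice j) 0 ≡ A j
  N-even-0 j = trans (N-even j 0) (trans (cong₂ _+_ (cong (A j *_) (N0-yes 0 (p ∣0))) (cong (B j *_) (Ψ0-yes 0 (p ∣0)))) (l (A j) (B j)))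
    where
    l : ∀ a b → a * 1 + b * 0 ≡ a
    l = solve-∀

  Ψ-even : ∀ j → Ψ (twice j) p 0 + A j ≡ p ^ twice j
  Ψ-even j = trans (cong (Ψ (twice j) p 0 +_) (sym (N-even-0 j))) (Ψ+N (twice j) 0)

  φ-prime : Ψ 1 p 0 + 1 ≡ p
  φ-prime = trans (cong (Ψ 1 p 0 +_) (sym N1-0)) (trans (Ψ+N 1 0) (*-identityʳ p))

  -- Summing N (2 j) over all shifts: A j + (p − 1) B j = p^(2j).
  A+φB : ∀ j → A j + B j * Ψ 1 p 0 ≡ p ^ twice j
  A+φB j = begin
      A j + B j * Ψ 1 p 0
    ≡⟨ cong₂ _+_ (trans (sym (*-identityʳ (A j))) (cong (A j *_) (sym ∑N0))) (cong (B j *_) (sym ∑Ψ0)) ⟩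
      A j * ∑ p (N 0) + B j * ∑ p (Ψ 0 p)
    ≡⟨ sym (∑-lin p (A j) (B j) (N 0) (Ψ 0 p)) ⟩
      ∑ p (λ a → A j * N 0 a + B j * Ψ 0 p a)
    ≡⟨ sym (∑-ext p (λ a → trans (cong (N (twice j)) (+-identityʳ a)) (N-even j a))) ⟩
      ∑ p (λ a → N (twice j) (a + 0))
    ≡⟨ N-total (twice j) 0 ⟩
      p ^ twice j ∎
    where
    open ≡-Reasoning
    ∑N0 : ∑ p (N 0) ≡ 1
    ∑N0 = trans (∑-ext p (λ a → cong (N 0) (sym (+-identityʳ a)))) (N-total 0 0)
    ∑Ψ0 : ∑ p (Ψ 0 p) ≡ Ψ 1 p 0
    ∑Ψ0 = +-cancelʳ-≡ 1 _ _
      (trans (cong (∑ p (Ψ 0 p) +_) (sym ∑N0))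
      (trans (sym (∑-+ p (Ψ 0 p) (N 0)))
      (trans (∑-ext p (λ a → Ψ+N 0 a))
      (trans (∑-const p 1) (trans (*-identityʳ p) (sym φ-prime))))))

  -- Odd k: Ψ (2 j + 1) p 0 = p^(2j) φ(p), since N (2 j + 1) 0 = A j + (p − 1) B j = p^(2j).
  Ψ-odd : ∀ j → Ψ (suc (twice j)) p 0 ≡ p ^ twice j * Ψ 1 p 0
  Ψ-odd j = +-cancelʳ-≡ (p ^ twice j) _ _
    (trans (cong (Ψ (suc (twice j)) p 0 +_) (sym N-odd-0))
    (trans (Ψ+N (suc (twice j)) 0)
    (trans (cong (_* p ^ twice j) (sym φ-prime)) (l (Ψ 1 p 0) (p ^ twice j)))))
    where
    l : ∀ g P → (g + 1) * P ≡ P * g + P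
    l = solve-∀
    N-odd-0 : N (suc (twice j)) 0 ≡ p ^ twice j
    N-odd-0 = trans (∑-ext p (λ x → N-even j (0 + x * x)))
              (trans (∑-lin p (A j) (B j) (λ x → N 0 (0 + x * x)) (λ x → Ψ 0 p (0 + x * x)))
              (trans (cong₂ _+_ (trans (cong (A j *_) N1-0) (*-identityʳ (A j))) refl) (A+φB j)))

module RationalEmbedding where

  open import Data.Nat as ℕ using (suc)
  open import Data.Integer as ℤ using (ℤ; +_)
  import Data.Integer.Properties as ℤP
  open import Data.Rational using (ℚ; _/_; 1ℚ; toℚᵘ) renaming (_*_ to _*ℚ_; _+_ to _+ℚ_; _-_ to _-ℚ_; -_ to -ℚ_)
  open import Data.Rational.Properties
    using (toℚᵘ-injective; toℚᵘ-fromℚᵘ; toℚᵘ-homo-*; toℚᵘ-homo-+; toℚᵘ-homo‿-)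
  open import Data.Rational.Properties using (*-distribˡ-+; *-identityʳ; neg-distribʳ-*; *-assoc; *-comm)
  open import Data.Rational.Unnormalised as ℚᵘ using (mkℚᵘ; *≡*) renaming (_≃_ to _≃ᵘ_)
  import Data.Rational.Unnormalised.Properties as ℚᵘP
  open import Relation.Binary.PropositionalEquality
  open import Data.Integer.Tactic.RingSolver using (solve-∀)
  open import Defs using (ℕtoℚ)

  ι : ℤ → ℚ
  ι z = z / 1

  toℚᵘ-ι : ∀ z → toℚᵘ (ι z) ≃ᵘ mkℚᵘ z 0
  toℚᵘ-ι z = toℚᵘ-fromℚᵘ (mkℚᵘ z 0)

  ι-* : ∀ a b → ι (a ℤ.* b) ≡ ι a *ℚ ι b
  ι-* a b = toℚᵘ-injective (ℚᵘP.≃-trans (toℚᵘ-ι (a ℤ.* b))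
              (ℚᵘP.≃-sym (ℚᵘP.≃-trans (toℚᵘ-homo-* (ι a) (ι b)) (ℚᵘP.*-cong (toℚᵘ-ι a) (toℚᵘ-ι b)))))

  ι-+ : ∀ a b → ι (a ℤ.+ b) ≡ ι a +ℚ ι b
  ι-+ a b = toℚᵘ-injective (ℚᵘP.≃-trans (toℚᵘ-ι (a ℤ.+ b))
              (ℚᵘP.≃-sym (ℚᵘP.≃-trans (toℚᵘ-homo-+ (ι a) (ι b))
                          (ℚᵘP.≃-trans (ℚᵘP.+-cong (toℚᵘ-ι a) (toℚᵘ-ι b)) (*≡* (l a b))))))
    where
    l : ∀ a b → (a ℤ.* ℤ.+ 1 ℤ.+ b ℤ.* ℤ.+ 1) ℤ.* ℤ.+ 1 ≡ (a ℤ.+ b) ℤ.* ℤ.+ 1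
    l = solve-∀

  ι-neg : ∀ a → ι (ℤ.- a) ≡ -ℚ ι a
  ι-neg a = toℚᵘ-injective (ℚᵘP.≃-trans (toℚᵘ-ι (ℤ.- a))
              (ℚᵘP.≃-sym (ℚᵘP.≃-trans (toℚᵘ-homo‿- (ι a)) (ℚᵘP.-‿cong (toℚᵘ-ι a)))))

  ℕtoℚ-* : ∀ a b → ℕtoℚ (a ℕ.* b) ≡ ℕtoℚ a *ℚ ℕtoℚ b
  ℕtoℚ-* a b = trans (cong ι (ℤP.pos-* a b)) (ι-* (+ a) (+ b))

  ι-cancel : ∀ s n → ι (+ suc n) *ℚ (s / suc n) ≡ ι s
  ι-cancel s n = toℚᵘ-injective
    (ℚᵘP.≃-trans (toℚᵘ-homo-* (ι (+ suc n)) (s / suc n))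
    (ℚᵘP.≃-trans (ℚᵘP.*-cong (toℚᵘ-ι (+ suc n)) (toℚᵘ-fromℚᵘ (mkℚᵘ s n)))
    (ℚᵘP.≃-trans (*≡* (trans (l (+ suc n) s) (cong (s ℤ.*_) (cong (λ z → + suc z) (sym (ℕP.+-identityʳ n))))))
                 (ℚᵘP.≃-sym (toℚᵘ-ι s)))))
    where
    import Data.Nat.Properties as ℕP
    l : ∀ a s → (a ℤ.* s) ℤ.* ℤ.+ 1 ≡ s ℤ.* a
    l = solve-∀

  factor-out : ∀ (X Y s : ℤ) d .{{_ : ℕ.NonZero d}} → X ≡ + d ℤ.* Y → ι X *ℚ (1ℚ -ℚ (s / d)) ≡ ι (X ℤ.- s ℤ.* Y)
  factor-out X Y s (suc n) X≡dY = begin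
      ι X *ℚ (1ℚ +ℚ (-ℚ (s / suc n)))
    ≡⟨ *-distribˡ-+ (ι X) 1ℚ (-ℚ (s / suc n)) ⟩
      ι X *ℚ 1ℚ +ℚ ι X *ℚ (-ℚ (s / suc n))
    ≡⟨ cong₂ _+ℚ_ (*-identityʳ (ι X)) (sym (neg-distribʳ-* (ι X) (s / suc n))) ⟩
      ι X +ℚ (-ℚ (ι X *ℚ (s / suc n)))
    ≡⟨ cong (λ z → ι X +ℚ (-ℚ z)) Xs/d≡sY ⟩
      ι X +ℚ (-ℚ ι (s ℤ.* Y))
    ≡⟨ cong (ι X +ℚ_) (sym (ι-neg (s ℤ.* Y))) ⟩
      ι X +ℚ ι (ℤ.- (s ℤ.* Y))
    ≡⟨ sym (ι-+ X (ℤ.- (s ℤ.* Y))) ⟩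
      ι (X ℤ.- s ℤ.* Y) ∎
    where
    open ≡-Reasoning
    Xs/d≡sY : ι X *ℚ (s / suc n) ≡ ι (s ℤ.* Y)
    Xs/d≡sY = begin
        ι X *ℚ (s / suc n)                    ≡⟨ cong (λ z → ι z *ℚ (s / suc n)) X≡dY ⟩
        ι (+ suc n ℤ.* Y) *ℚ (s / suc n)      ≡⟨ cong (_*ℚ (s / suc n)) (trans (ι-* (+ suc n) Y) (*-comm (ι (+ suc n)) (ι Y))) ⟩
        (ι Y *ℚ ι (+ suc n)) *ℚ (s / suc n)   ≡⟨ *-assoc (ι Y) (ι (+ suc n)) (s / suc n) ⟩
        ι Y *ℚ (ι (+ suc n) *ℚ (s / suc n))   ≡⟨ cong (ι Y *ℚ_) (ι-cancel s n) ⟩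
        ι Y *ℚ ι s                            ≡⟨ sym (ι-* Y s) ⟩
        ι (Y ℤ.* s)                           ≡⟨ cong ι (ℤP.*-comm Y s) ⟩
        ι (s ℤ.* Y)                           ∎

-- With ε = (−1)^((p−1)/2) one has
-- N 2 0 = p + ε (p − 1) and N 2 1 = p − ε, and solving the recurrence for (A, B) in ℤ gives
--   Φ_{2j}(p) = p^(2j−1) (p − 1) (1 − ε^j / p^j),   Φ_{2j+1}(p) = p^(2j) (p − 1).
module OddPrimeValue (t : ℕ) (prime : Prime (3 + 2 * t)) where

  open import Data.Nat
  open import Data.Nat.Properties
  open import Data.Nat.DivMod using (_/_; m*n/n≡m)
  open import Data.Integer as ℤ using (ℤ; +_; 1ℤ; -1ℤ)
  import Data.Integer.Properties as ℤP
  open import Data.Rational using (1ℚ) renaming (_/_ to _/ℚ_; _*_ to _*ℚ_; _-_ to _-ℚ_)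
  import Data.Rational.Properties as ℚP
  open import Data.Product using (Σ; _×_; _,_; proj₁; proj₂)
  open import Data.Sum using (_⊎_; inj₁; inj₂)
  open import Relation.Binary.PropositionalEquality
  open import Data.Nat.Tactic.RingSolver using (solve-∀)
  open import Data.Integer.Tactic.RingSolver renaming (solve-∀ to ℤsolve-∀)
  open import Defs using (ℕtoℚ; factor)
  open Counting using (Ψ)
  open RationalEmbedding
  open OddPrime t prime
  open TwoSquares t prime using (N1+N2)
  open MinusOne t prime using (minus-one-square)
  open Recurrence t prime

  P : ℤ
  P = + p

  pos-^ : ∀ m n → + (m ^ n) ≡ (+ m) ℤ.^ n
  pos-^ m zero    = refl
  pos-^ m (suc n) = trans (ℤP.pos-* m (m ^ n)) (cong ((+ m) ℤ.*_) (pos-^ m n))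

  pos-∸ : ∀ a b c → a + b ≡ c → + a ≡ + c ℤ.- + b
  pos-∸ a b c e = trans (l (+ a) (+ b)) (cong (ℤ._- + b) (trans (sym (ℤP.pos-+ a b)) (cong +_ e)))
    where
    l : ∀ a b → a ≡ (a ℤ.+ b) ℤ.- b
    l = ℤsolve-∀

  pos-affine : ∀ a b t → + (a + b * t) ≡ + a ℤ.+ + b ℤ.* + t
  pos-affine a b t = trans (ℤP.pos-+ a (b * t)) (cong (λ z → + a ℤ.+ z) (ℤP.pos-* b t))

  P≡ : P ≡ + 3 ℤ.+ + 2 ℤ.* + t
  P≡ = trans (cong +_ p≡) (pos-affine 3 2 t)

  p²≡ : + (p ^ 2) ≡ P ℤ.* P
  p²≡ = trans (pos-^ p 2) (cong (P ℤ.*_) (ℤP.*-identityʳ P))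

  φ≡ : + Ψ 1 p 0 ≡ P ℤ.- 1ℤ
  φ≡ = pos-∸ (Ψ 1 p 0) 1 p φ-prime

  twice≡ : ∀ n → twice n ≡ 2 * n
  twice≡ zero    = refl
  twice≡ (suc n) = trans (cong (λ z → suc (suc z)) (twice≡ n)) (l n)
    where
    l : ∀ n → 2 + 2 * n ≡ 2 * suc n
    l = solve-∀

  ε : ℤ
  ε = -1ℤ ℤ.^ (1 + t)

  -1^even : ∀ y → -1ℤ ℤ.^ (2 * y) ≡ 1ℤ
  -1^even y = trans (sym (ℤP.^-*-assoc -1ℤ 2 y)) (ℤP.^-zeroˡ y)

  -- N 2 0 = p + ε (p − 1) and N 2 1 = p − ε, from N 2 0 = 1 + (p − 1) N 1 1, N 1 1 + N 2 1 = p + 1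
  -- and the value of N 1 1 determined by the parity of t.
  N2-closed : (+ N 2 0 ≡ P ℤ.+ ε ℤ.* (P ℤ.- 1ℤ)) × (+ N 2 1 ≡ P ℤ.- ε)
  N2-closed = byParity minus-one-square
    where
    byParity : (N 1 1 ≡ 0 × Σ ℕ λ e → t ≡ 2 * e) ⊎ (N 1 1 ≡ 2 × Σ ℕ λ e → t ≡ 1 + 2 * e) →
               (+ N 2 0 ≡ P ℤ.+ ε ℤ.* (P ℤ.- 1ℤ)) × (+ N 2 1 ≡ P ℤ.- ε)
    byParity (inj₁ (N≡0 , e , t≡2e)) = N20 , N21
      where
      ε≡-1 : ε ≡ -1ℤ
      ε≡-1 = trans (cong (λ s → -1ℤ ℤ.^ (1 + s)) t≡2e) (cong (-1ℤ ℤ.*_) (-1^even e))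
      N20 : + N 2 0 ≡ P ℤ.+ ε ℤ.* (P ℤ.- 1ℤ)
      N20 = trans (cong +_ (trans N2-0 (trans (cong (λ m → 1 + q * m) N≡0) (cong suc (*-zeroʳ q)))))
                  (trans (l P) (cong (λ s → P ℤ.+ s ℤ.* (P ℤ.- 1ℤ)) (sym ε≡-1)))
        where
        l : ∀ P → + 1 ≡ P ℤ.+ -1ℤ ℤ.* (P ℤ.- 1ℤ)
        l = ℤsolve-∀
      N21 : + N 2 1 ≡ P ℤ.- ε
      N21 = trans (cong +_ (trans (cong (_+ N 2 1) (sym N≡0)) N1+N2))
                  (trans (pos-affine 4 2 t) (trans (l (+ t)) (cong₂ ℤ._-_ (sym P≡) (sym ε≡-1))))
        where
        l : ∀ τ → + 4 ℤ.+ + 2 ℤ.* τ ≡ (+ 3 ℤ.+ + 2 ℤ.* τ) ℤ.- -1ℤ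
        l = ℤsolve-∀
    byParity (inj₂ (N≡2 , e , t≡1+2e)) = N20 , N21
      where
      ε≡1 : ε ≡ 1ℤ
      ε≡1 = trans (cong (λ s → -1ℤ ℤ.^ (1 + s)) t≡1+2e) (cong (λ z → -1ℤ ℤ.* (-1ℤ ℤ.* z)) (-1^even e))
      N20 : + N 2 0 ≡ P ℤ.+ ε ℤ.* (P ℤ.- 1ℤ)
      N20 = trans (cong +_ (trans N2-0 (trans (cong (λ m → 1 + q * m) N≡2) (l t))))
                  (trans (pos-affine 5 4 t) (trans (r (+ t)) (cong₂ (λ P s → P ℤ.+ s ℤ.* (P ℤ.- 1ℤ)) (sym P≡) (sym ε≡1))))
        where
        l : ∀ t → 1 + (2 + 2 * t) * 2 ≡ 5 + 4 * t
        l = solve-∀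
        r : ∀ τ → + 5 ℤ.+ + 4 ℤ.* τ ≡ (+ 3 ℤ.+ + 2 ℤ.* τ) ℤ.+ 1ℤ ℤ.* ((+ 3 ℤ.+ + 2 ℤ.* τ) ℤ.- 1ℤ)
        r = ℤsolve-∀
      N21 : + N 2 1 ≡ P ℤ.- ε
      N21 = trans (cong +_ (+-cancelˡ-≡ 2 _ _ (trans (cong (_+ N 2 1) (sym N≡2)) (trans N1+N2 (l t)))))
                  (trans (pos-affine 2 2 t) (trans (r (+ t)) (cong₂ ℤ._-_ (sym P≡) (sym ε≡1))))
        where
        l : ∀ t → 4 + 2 * t ≡ 2 + (2 + 2 * t)
        l = solve-∀
        r : ∀ τ → + 2 ℤ.+ + 2 ℤ.* τ ≡ (+ 3 ℤ.+ + 2 ℤ.* τ) ℤ.- 1ℤ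
        r = ℤsolve-∀

  Ψ2≡ : ∀ b → + Ψ 2 p b ≡ P ℤ.* P ℤ.- + N 2 b
  Ψ2≡ b = trans (pos-∸ (Ψ 2 p b) (N 2 b) (p ^ 2) (Ψ+N 2 b)) (cong (ℤ._- + N 2 b) p²≡)

  X Y : ℕ → ℤ
  X i = P ℤ.^ suc (twice i)
  Y i = P ℤ.^ i

  AB-closed : ∀ i → (+ A (suc i) ≡ X i ℤ.+ ε ℤ.^ suc i ℤ.* (P ℤ.- 1ℤ) ℤ.* Y i) × (+ B (suc i) ≡ X i ℤ.- ε ℤ.^ suc i ℤ.* Y i)
  AB-closed zero =
    trans (cong +_ (l (N 2 0) (Ψ 2 p 0))) (trans (proj₁ N2-closed) (r₀ P ε)) ,
    trans (cong +_ (l (N 2 1) (Ψ 2 p 1))) (trans (proj₂ N2-closed) (r₁ P ε))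
    where
    l : ∀ a b → 1 * a + 0 * b ≡ a
    l = solve-∀
    r₀ : ∀ P ε → P ℤ.+ ε ℤ.* (P ℤ.- 1ℤ) ≡ P ℤ.* 1ℤ ℤ.+ ε ℤ.* 1ℤ ℤ.* (P ℤ.- 1ℤ) ℤ.* 1ℤ
    r₀ = ℤsolve-∀
    r₁ : ∀ P ε → P ℤ.- ε ≡ P ℤ.* 1ℤ ℤ.- ε ℤ.* 1ℤ ℤ.* 1ℤ
    r₁ = ℤsolve-∀
  AB-closed (suc i) = A≡ , B≡
    where
    e = ε ℤ.^ suc i
    IHA = proj₁ (AB-closed i)
    IHB = proj₂ (AB-closed i)
    N20 = proj₁ N2-closed
    N21 = proj₂ N2-closed
    stepA : ∀ X Y e ε P → (X ℤ.+ e ℤ.* (P ℤ.- 1ℤ) ℤ.* Y) ℤ.* (P ℤ.+ ε ℤ.* (P ℤ.- 1ℤ))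
                          ℤ.+ (X ℤ.- e ℤ.* Y) ℤ.* (P ℤ.* P ℤ.- (P ℤ.+ ε ℤ.* (P ℤ.- 1ℤ)))
                          ≡ P ℤ.* (P ℤ.* X) ℤ.+ (ε ℤ.* e) ℤ.* (P ℤ.- 1ℤ) ℤ.* (P ℤ.* Y)
    stepA = ℤsolve-∀
    stepB : ∀ X Y e ε P → (X ℤ.+ e ℤ.* (P ℤ.- 1ℤ) ℤ.* Y) ℤ.* (P ℤ.- ε) ℤ.+ (X ℤ.- e ℤ.* Y) ℤ.* (P ℤ.* P ℤ.- (P ℤ.- ε))
                          ≡ P ℤ.* (P ℤ.* X) ℤ.- (ε ℤ.* e) ℤ.* (P ℤ.* Y)
    stepB = ℤsolve-∀
    A≡ : + (A (suc i) * N 2 0 + B (suc i) * Ψ 2 p 0) ≡ X (suc i) ℤ.+ ε ℤ.^ suc (suc i) ℤ.* (P ℤ.- 1ℤ) ℤ.* Y (suc i)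
    A≡ = trans (ℤP.pos-+ (A (suc i) * N 2 0) (B (suc i) * Ψ 2 p 0))
         (trans (cong₂ ℤ._+_ (ℤP.pos-* (A (suc i)) (N 2 0)) (ℤP.pos-* (B (suc i)) (Ψ 2 p 0)))
         (trans (cong₂ ℤ._+_ (cong₂ ℤ._*_ IHA N20) (cong₂ ℤ._*_ IHB (trans (Ψ2≡ 0) (cong (λ z → P ℤ.* P ℤ.- z) N20))))
                (stepA (X i) (Y i) e ε P)))
    B≡ : + (A (suc i) * N 2 1 + B (suc i) * Ψ 2 p 1) ≡ X (suc i) ℤ.- ε ℤ.^ suc (suc i) ℤ.* Y (suc i)
    B≡ = trans (ℤP.pos-+ (A (suc i) * N 2 1) (B (suc i) * Ψ 2 p 1))
         (trans (cong₂ ℤ._+_ (ℤP.pos-* (A (suc i)) (N 2 1)) (ℤP.pos-* (B (suc i)) (Ψ 2 p 1)))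
         (trans (cong₂ ℤ._+_ (cong₂ ℤ._*_ IHA N21) (cong₂ ℤ._*_ IHB (trans (Ψ2≡ 1) (cong (λ z → P ℤ.* P ℤ.- z) N21))))
                (stepB (X i) (Y i) e ε P)))

  Ψ-even-ℤ : ∀ i → + Ψ (twice (suc i)) p 0 ≡ (X i ℤ.* (P ℤ.- 1ℤ)) ℤ.- ε ℤ.^ suc i ℤ.* ((P ℤ.- 1ℤ) ℤ.* Y i)
  Ψ-even-ℤ i = trans (pos-∸ (Ψ (twice (suc i)) p 0) (A (suc i)) _ (Ψ-even (suc i)))
               (trans (cong₂ ℤ._-_ (pos-^ p (twice (suc i))) (proj₁ (AB-closed i))) (l (X i) (Y i) (ε ℤ.^ suc i) P))
    where
    l : ∀ X Y e P → P ℤ.* X ℤ.- (X ℤ.+ e ℤ.* (P ℤ.- 1ℤ) ℤ.* Y) ≡ (X ℤ.* (P ℤ.- 1ℤ)) ℤ.- e ℤ.* ((P ℤ.- 1ℤ) ℤ.* Y)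
    l = ℤsolve-∀

  main-term : ∀ i → X i ℤ.* (P ℤ.- 1ℤ) ≡ + (p ^ suc i) ℤ.* ((P ℤ.- 1ℤ) ℤ.* Y i)
  main-term i = trans (cong (ℤ._* (P ℤ.- 1ℤ)) (trans (cong (λ n → P ℤ.^ suc n) (trans (twice≡ i) (l i)))
                                                     (ℤP.^-distribˡ-+-* P (suc i) i)))
                (trans (r (P ℤ.^ suc i) (Y i) P) (cong (ℤ._* ((P ℤ.- 1ℤ) ℤ.* Y i)) (sym (pos-^ p (suc i)))))
    where
    l : ∀ i → 2 * i ≡ i + i
    l = solve-∀
    r : ∀ a b P → (a ℤ.* b) ℤ.* (P ℤ.- 1ℤ) ≡ a ℤ.* ((P ℤ.- 1ℤ) ℤ.* b)
    r = ℤsolve-∀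

  Ψ-even-ℚ : ∀ i → ℕtoℚ (Ψ (twice (suc i)) p 0)
               ≡ ℕtoℚ (p ^ suc (twice i) * Ψ 1 p 0) *ℚ (1ℚ -ℚ _/ℚ_ (ε ℤ.^ suc i) (p ^ suc i) {{m^n≢0 p (suc i)}})
  Ψ-even-ℚ i = trans (cong ι (Ψ-even-ℤ i)) (sym
    (trans (cong (λ z → ι z *ℚ (1ℚ -ℚ _/ℚ_ (ε ℤ.^ suc i) (p ^ suc i) {{m^n≢0 p (suc i)}})) mainℤ)
           (factor-out (X i ℤ.* (P ℤ.- 1ℤ)) ((P ℤ.- 1ℤ) ℤ.* Y i) (ε ℤ.^ suc i) (p ^ suc i) {{m^n≢0 p (suc i)}} (main-term i))))
    where
    mainℤ : + (p ^ suc (twice i) * Ψ 1 p 0) ≡ X i ℤ.* (P ℤ.- 1ℤ)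
    mainℤ = trans (ℤP.pos-* (p ^ suc (twice i)) (Ψ 1 p 0)) (cong₂ ℤ._*_ (pos-^ p (suc (twice i))) φ≡)

  sign : ∀ i → ε ℤ.^ suc i ≡ -1ℤ ℤ.^ ((2 * suc i * (2 + 2 * t)) / 4)
  sign i = trans (ℤP.^-*-assoc -1ℤ (1 + t) (suc i))
                 (cong (-1ℤ ℤ.^_) (sym (trans (cong (_/ 4) (l (suc i) t)) (m*n/n≡m ((1 + t) * suc i) 4))))
    where
    l : ∀ a t → 2 * a * (2 + 2 * t) ≡ (1 + t) * a * 4
    l = solve-∀

  odd-value : ∀ j → Ψ (suc (2 * j)) (3 + 2 * t) 0 ≡ (3 + 2 * t) ^ (2 * j) * Ψ 1 (3 + 2 * t) 0
  odd-value j = subst (λ P → Ψ (suc (2 * j)) P 0 ≡ P ^ (2 * j) * Ψ 1 P 0) p≡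
                  (subst (λ d → Ψ (suc d) p 0 ≡ p ^ d * Ψ 1 p 0) (twice≡ j) (Ψ-odd j))

  even-value : ∀ i → ℕtoℚ (Ψ (2 * suc i) (3 + 2 * t) 0)
                     ≡ ℕtoℚ ((3 + 2 * t) ^ (2 * suc i ∸ 1) * Ψ 1 (3 + 2 * t) 0) *ℚ factor (2 * suc i) (1 + 2 * t)
  even-value i = subst (λ P → ℕtoℚ (Ψ (2 * suc i) P 0) ≡ ℕtoℚ (P ^ (2 * suc i ∸ 1) * Ψ 1 P 0) *ℚ factor (2 * suc i) (1 + 2 * t))
                       p≡ atP
    where
    K≡ : twice (suc i) ≡ 2 * suc i
    K≡ = twice≡ (suc i)
    m≡ : suc (twice i) ≡ 2 * suc i ∸ 1
    m≡ = cong (_∸ 1) K≡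
    half : (2 * suc i) / 2 ≡ suc i
    half = trans (cong (_/ 2) (*-comm 2 (suc i))) (m*n/n≡m (suc i) 2)
    factor≡ : 1ℚ -ℚ _/ℚ_ (ε ℤ.^ suc i) (p ^ suc i) {{m^n≢0 p (suc i)}} ≡ factor (2 * suc i) (1 + 2 * t)
    factor≡ = cong (1ℚ -ℚ_) (ℚP./-cong {{m^n≢0 p (suc i)}} {{m^n≢0 (3 + 2 * t) ((2 * suc i) / 2)}}
                                 (sign i) (trans (cong (_^ suc i) p≡) (cong ((3 + 2 * t) ^_) (sym half))))
    atP : ℕtoℚ (Ψ (2 * suc i) p 0) ≡ ℕtoℚ (p ^ (2 * suc i ∸ 1) * Ψ 1 p 0) *ℚ factor (2 * suc i) (1 + 2 * t)
    atP = subst₂ (λ K m → ℕtoℚ (Ψ K p 0) ≡ ℕtoℚ (p ^ m * Ψ 1 p 0) *ℚ factor (2 * suc i) (1 + 2 * t)) K≡ m≡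
                 (trans (Ψ-even-ℚ i) (cong (ℕtoℚ (p ^ suc (twice i) * Ψ 1 p 0) *ℚ_) factor≡))

module ProductFacts where

  open import Data.Nat
  open import Data.Nat.Properties
  open import Data.Nat.DivMod using (_%_; [m+kn]%n≡m%n)
  open import Data.Nat.Divisibility
  open import Data.Nat.Primality using (Prime; prime?; euclidsLemma; prime⇒irreducible; prime⇒nonZero)
  open import Data.Nat.Coprimality using (Coprime)
  open import Data.Rational using (ℚ; 1ℚ) renaming (_*_ to _*ℚ_)
  import Data.Rational.Properties as ℚP
  open import Algebra.Bundles using (CommutativeMonoid)
  open import Algebra.Properties.CommutativeSemigroup
    (CommutativeMonoid.commutativeSemigroup ℚP.*-1-commutativeMonoid) using (interchange)
  open import Data.Product using (_×_; _,_)
  open import Data.Sum using (_⊎_; inj₁; inj₂)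
  open import Data.Empty using (⊥; ⊥-elim)
  open import Relation.Nullary using (Dec; yes; no; ¬_)
  open import Relation.Nullary.Decidable using (_×-dec_)
  open import Relation.Unary using (Pred; Decidable)
  open import Data.List using (filter; foldr; applyUpTo)
  open import Relation.Binary.PropositionalEquality
  open import Data.Nat.Tactic.RingSolver using (solve-∀)
  open import Defs using (oddPrimeProduct; factor)

  sel : ∀ {a} {P : Set a} → Dec P → ℚ → ℚ
  sel (yes _) x = x
  sel (no _)  _ = 1ℚ

  sel-no : ∀ {a} {P : Set a} (d : Dec P) x → ¬ P → sel d x ≡ 1ℚ
  sel-no (yes p) x ¬p = ⊥-elim (¬p p)
  sel-no (no _)  x _  = refl

  sel-cong : ∀ {a b} {P : Set a} {Q : Set b} (d : Dec P) (e : Dec Q) x → (P → Q) → (Q → P) → sel d x ≡ sel e x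
  sel-cong (yes _) (yes _) x f g = refl
  sel-cong (yes p) (no ¬q) x f g = ⊥-elim (¬q (f p))
  sel-cong (no ¬p) (yes q) x f g = ⊥-elim (¬p (g q))
  sel-cong (no _)  (no _)  x f g = refl

  sel-⊎ : ∀ {a b c} {A : Set a} {B : Set b} {C : Set c} (dA : Dec A) (dB : Dec B) (dC : Dec C) x →
    (A → B ⊎ C) → (B → A) → (C → A) → (B → C → ⊥) → sel dA x ≡ sel dB x *ℚ sel dC x
  sel-⊎ (yes a) (yes b) (yes c) x f g h disj = ⊥-elim (disj b c)
  sel-⊎ (yes a) (yes b) (no _)  x f g h disj = sym (ℚP.*-identityʳ x)
  sel-⊎ (yes a) (no _)  (yes c) x f g h disj = sym (ℚP.*-identityˡ x)
  sel-⊎ (yes a) (no ¬b) (no ¬c) x f g h disj with f a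
  ... | inj₁ b = ⊥-elim (¬b b)
  ... | inj₂ c = ⊥-elim (¬c c)
  sel-⊎ (no ¬a) (yes b) _       x f g h disj = ⊥-elim (¬a (g b))
  sel-⊎ (no ¬a) (no _)  (yes c) x f g h disj = ⊥-elim (¬a (h c))
  sel-⊎ (no ¬a) (no _)  (no _)  x f g h disj = refl

  ∏ : ℕ → (ℕ → ℚ) → ℚ
  ∏ zero    f = 1ℚ
  ∏ (suc N) f = f 0 *ℚ ∏ N (λ i → f (suc i))

  ∏-cong : ∀ N {f g : ℕ → ℚ} → (∀ i → i < N → f i ≡ g i) → ∏ N f ≡ ∏ N g
  ∏-cong zero    h = refl
  ∏-cong (suc N) h = cong₂ _*ℚ_ (h 0 z<s) (∏-cong N (λ i i<N → h (suc i) (s≤s i<N)))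

  ∏-one : ∀ N (f : ℕ → ℚ) → (∀ i → i < N → f i ≡ 1ℚ) → ∏ N f ≡ 1ℚ
  ∏-one zero    f h = refl
  ∏-one (suc N) f h = trans (cong₂ _*ℚ_ (h 0 z<s) (∏-one N _ (λ i i<N → h (suc i) (s≤s i<N)))) (ℚP.*-identityˡ 1ℚ)

  ∏-split : ∀ a b (f : ℕ → ℚ) → ∏ (a + b) f ≡ ∏ a f *ℚ ∏ b (λ i → f (a + i))
  ∏-split zero    b f = sym (ℚP.*-identityˡ _)
  ∏-split (suc a) b f = trans (cong (f 0 *ℚ_) (∏-split a b (λ i → f (suc i)))) (sym (ℚP.*-assoc (f 0) _ _))

  ∏-* : ∀ N (f g : ℕ → ℚ) → ∏ N (λ i → f i *ℚ g i) ≡ ∏ N f *ℚ ∏ N g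
  ∏-* zero    f g = sym (ℚP.*-identityˡ 1ℚ)
  ∏-* (suc N) f g = trans (cong ((f 0 *ℚ g 0) *ℚ_) (∏-* N (λ i → f (suc i)) (λ i → g (suc i)))) (interchange (f 0) (g 0) _ _)

  ∏-point : ∀ N j (f : ℕ → ℚ) → j < N → ∏ N (λ i → sel (i ≟ j) (f i)) ≡ f j
  ∏-point (suc N) zero f _ =
    trans (cong (f 0 *ℚ_) (∏-one N _ (λ i _ → sel-no (suc i ≟ 0) (f (suc i)) (λ ())))) (ℚP.*-identityʳ (f 0))
  ∏-point (suc N) (suc j) f (s≤s j<N) =
    trans (cong₂ _*ℚ_ (sel-no (0 ≟ suc j) (f 0) (λ ()))
                      (trans (∏-cong N (λ i _ → sel-cong (suc i ≟ suc j) (i ≟ j) (f (suc i)) suc-injective (cong suc)))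
                             (∏-point N j (λ i → f (suc i)) j<N)))
          (ℚP.*-identityˡ (f (suc j)))

  foldr-filter : ∀ {p} {P : Pred ℕ p} (P? : Decidable P) (g : ℕ → ℚ) (f : ℕ → ℕ) N →
    foldr (λ i r → g i *ℚ r) 1ℚ (filter P? (applyUpTo f N)) ≡ ∏ N (λ i → sel (P? (f i)) (g (f i)))
  foldr-filter P? g f zero    = refl
  foldr-filter P? g f (suc N) with P? (f 0)
  ... | yes _ = cong (g (f 0) *ℚ_) (foldr-filter P? g (λ i → f (suc i)) N)
  ... | no _  = trans (foldr-filter P? g (λ i → f (suc i)) N) (sym (ℚP.*-identityˡ _))

  OddPrimeDivisor : ℕ → ℕ → Set
  OddPrimeDivisor n i = Prime (2 + i) × ((2 + i) % 2 ≡ 1 × (2 + i) ∣ n)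

  oddPrimeDivisor? : ∀ n i → Dec (OddPrimeDivisor n i)
  oddPrimeDivisor? n i = prime? (2 + i) ×-dec (((2 + i) % 2 ≟ 1) ×-dec ((2 + i) ∣? n))

  term : ℕ → ℕ → ℕ → ℚ
  term k n i = sel (oddPrimeDivisor? n i) (factor k i)

  oddPrimeProduct-∏ : ∀ k n → oddPrimeProduct k n ≡ ∏ n (term k n)
  oddPrimeProduct-∏ k n = foldr-filter (oddPrimeDivisor? n) (factor k) (λ i → i) n

  oddPrimeProduct-extend : ∀ k n M → 1 ≤ n → ∏ (n + M) (term k n) ≡ oddPrimeProduct k n
  oddPrimeProduct-extend k n M 1≤n =
    trans (∏-split n M (term k n))
          (trans (cong (∏ n (term k n) *ℚ_) (∏-one M _ (λ i _ → sel-no (oddPrimeDivisor? n (n + i)) _ (too-big i))))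
                 (trans (ℚP.*-identityʳ _) (sym (oddPrimeProduct-∏ k n))))
    where
    too-big : ∀ i → ¬ OddPrimeDivisor n (n + i)
    too-big i (_ , _ , d) = <⇒≱ (≤-trans (s≤s (m≤m+n n i)) (n≤1+n _)) (∣⇒≤ {{≢-nonZero (λ e → <⇒≱ 1≤n (≤-reflexive e))}} d)

  oddPrimeProduct-one : ∀ k → oddPrimeProduct k 1 ≡ 1ℚ
  oddPrimeProduct-one k =
    trans (oddPrimeProduct-∏ k 1) (trans (cong (_*ℚ 1ℚ) (sel-no (oddPrimeDivisor? 1 0) (factor k 0) 2∤1)) (ℚP.*-identityˡ 1ℚ))
    where
    2∤1 : ¬ OddPrimeDivisor 1 0
    2∤1 (_ , _ , d) = <⇒≱ (s≤s (s≤s z≤n)) (∣⇒≤ d)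

  ∏-prime-multiple : ∀ p n f → Prime p → 1 ≤ n → ∏ (p * n) f ≡ ∏ (n + pred p * n) f
  ∏-prime-multiple p n f pp _ = cong (λ z → ∏ z f) (cong (_* n) (sym (suc-pred p {{prime⇒nonZero pp}})))

  oddPrimeProduct-lift : ∀ k p n → Prime p → 1 ≤ n → p ∣ n → oddPrimeProduct k (p * n) ≡ oddPrimeProduct k n
  oddPrimeProduct-lift k p n pp 1≤n p∣n =
    trans (oddPrimeProduct-∏ k (p * n))
    (trans (∏-cong (p * n) (λ i _ → sel-cong (oddPrimeDivisor? (p * n) i) (oddPrimeDivisor? n i) (factor k i) to from))
    (trans (∏-prime-multiple p n (term k n) pp 1≤n) (oddPrimeProduct-extend k n (pred p * n) 1≤n)))
    where
    to : ∀ {i} → OddPrimeDivisor (p * n) i → OddPrimeDivisor n i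
    to {i} (prime-i , odd , d) with euclidsLemma p n prime-i d
    ... | inj₂ d′ = prime-i , odd , d′
    ... | inj₁ d′ with prime⇒irreducible pp d′
    ...   | inj₁ ()
    ...   | inj₂ e = prime-i , odd , subst (_∣ n) (sym e) p∣n
    from : ∀ {i} → OddPrimeDivisor n i → OddPrimeDivisor (p * n) i
    from (prime-i , odd , d) = prime-i , odd , ∣n⇒∣m*n p d

  IsOdd= : ℕ → ℕ → Set
  IsOdd= p i = 2 + i ≡ p × (2 + i) % 2 ≡ 1

  isOdd=? : ∀ p i → Dec (IsOdd= p i)
  isOdd=? p i = (2 + i ≟ p) ×-dec ((2 + i) % 2 ≟ 1)

  -- The factor contributed by a new prime p: the factor of p if p is odd, 1 if p = 2.
  newFactor : ℕ → ℕ → ℕ → ℚ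
  newFactor k p N = ∏ N (λ i → sel (isOdd=? p i) (factor k i))

  oddPrimeProduct-new : ∀ k p n → Prime p → 1 ≤ n → Coprime p n →
    oddPrimeProduct k (p * n) ≡ oddPrimeProduct k n *ℚ newFactor k p (p * n)
  oddPrimeProduct-new k p n pp 1≤n cop =
    trans (oddPrimeProduct-∏ k (p * n))
    (trans (∏-cong (p * n) (λ i _ → sel-⊎ (oddPrimeDivisor? (p * n) i) (oddPrimeDivisor? n i) (isOdd=? p i) (factor k i)
                                           split old new disjoint))
    (trans (∏-* (p * n) (term k n) (λ i → sel (isOdd=? p i) (factor k i)))
           (cong (_*ℚ newFactor k p (p * n))
                 (trans (∏-prime-multiple p n (term k n) pp 1≤n) (oddPrimeProduct-extend k n (pred p * n) 1≤n)))))
    where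
    split : ∀ {i} → OddPrimeDivisor (p * n) i → OddPrimeDivisor n i ⊎ IsOdd= p i
    split {i} (prime-i , odd , d) with euclidsLemma p n prime-i d
    ... | inj₂ d′ = inj₁ (prime-i , odd , d′)
    ... | inj₁ d′ with prime⇒irreducible pp d′
    ...   | inj₁ ()
    ...   | inj₂ e = inj₂ (e , odd)
    old : ∀ {i} → OddPrimeDivisor n i → OddPrimeDivisor (p * n) i
    old (prime-i , odd , d) = prime-i , odd , ∣n⇒∣m*n p d
    new : ∀ {i} → IsOdd= p i → OddPrimeDivisor (p * n) i
    new (e , odd) = subst Prime (sym e) pp , odd , subst (_∣ p * n) (sym e) (m∣m*n n)
    disjoint : ∀ {i} → OddPrimeDivisor n i → IsOdd= p i → ⊥
    disjoint {i} (_ , _ , d) (e , _) with cop (subst (2 + i ∣_) e ∣-refl , d)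
    ... | ()

  newFactor-two : ∀ k N → newFactor k 2 N ≡ 1ℚ
  newFactor-two k N = ∏-one N _ (λ i _ → sel-no (isOdd=? 2 i) (factor k i) (λ { (e , odd) → 0≢1+n (trans (cong (_% 2) (sym e)) odd) }))

  newFactor-odd : ∀ k t N → 2 + 2 * t < N → newFactor k (3 + 2 * t) N ≡ factor k (1 + 2 * t)
  newFactor-odd k t N bound =
    trans (∏-cong N (λ i _ → sel-cong (isOdd=? (3 + 2 * t) i) (i ≟ 1 + 2 * t) (factor k i)
                               (λ { (e , _) → suc-injective (suc-injective e) }) (λ { refl → refl , odd })))
          (∏-point N (1 + 2 * t) (factor k) (≤-trans (s≤s (n≤1+n (1 + 2 * t))) bound))
    where
    odd : (3 + 2 * t) % 2 ≡ 1
    odd = trans (cong (_% 2) (l t)) ([m+kn]%n≡m%n 1 (1 + t) 2)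
      where
      l : ∀ t → 3 + 2 * t ≡ 1 + (1 + t) * 2
      l = solve-∀

module Formula where

  open import Data.Nat
  open import Data.Nat.Properties
  open import Data.Nat.DivMod using (_%_; _/_; m%n<n; m≡m%n+[m/n]*n)
  open import Data.Nat.Divisibility
  open import Data.Nat.Primality using (Prime; prime⇒irreducible; ¬prime[1]; productOfPrimes≥1)
  open import Data.Nat.Primality.Factorisation using (factorise; PrimeFactorisation)
  open import Data.Nat.Coprimality using (Coprime)
  open import Data.Nat.ListAction using (product)
  open import Data.List using ([]; _∷_)
  open import Data.List.Relation.Unary.All using (All; []; _∷_)
  open import Data.Rational using (1ℚ) renaming (_*_ to _*ℚ_)
  import Data.Rational.Properties as ℚP
  open import Algebra.Bundles using (CommutativeMonoid)
  open import Algebra.Properties.CommutativeSemigroup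
    (CommutativeMonoid.commutativeSemigroup ℚP.*-1-commutativeMonoid) using (interchange)
  open import Data.Product using (Σ; _,_)
  open import Data.Sum using (_⊎_; inj₁; inj₂)
  open import Data.Empty using (⊥-elim)
  open import Relation.Nullary using (Dec; yes; no; ¬_)
  open import Relation.Binary.PropositionalEquality
  open import Data.Nat.Tactic.RingSolver using (solve-∀)
  open import Defs using (ℕtoℚ; oddPrimeProduct)
  open Counting using (Ψ)
  open Multiplicative
  open RationalEmbedding using (ℕtoℚ-*)
  open ProductFacts

  factor-induction : (P : ℕ → Set) → P 1 → (∀ p n → Prime p → 1 ≤ n → P n → P (p * n)) → ∀ n → n ≥ 1 → P n
  factor-induction P base step n@(suc _) _ =
    subst P (sym (PrimeFactorisation.isFactorisation f)) (go (PrimeFactorisation.factors f) (PrimeFactorisation.factorsPrime f))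
    where
    f = factorise n
    go : ∀ ps → All Prime ps → P (product ps)
    go []       _            = base
    go (p ∷ ps) (pp ∷ ppps) = step p (product ps) pp (productOfPrimes≥1 ppps) (go ps ppps)

  prime-cases : ∀ p → Prime p → p ≡ 2 ⊎ Σ ℕ (λ t → p ≡ 3 + 2 * t)
  prime-cases p pp = byRemainder (p % 2) refl (m%n<n p 2)
    where
    p≡ : p ≡ p % 2 + (p / 2) * 2
    p≡ = m≡m%n+[m/n]*n p 2
    byQuotient : ∀ h → p / 2 ≡ h → p % 2 ≡ 1 → p ≡ 2 ⊎ Σ ℕ (λ t → p ≡ 3 + 2 * t)
    byQuotient zero    h≡ r≡ = ⊥-elim (¬prime[1] (subst Prime (trans p≡ (cong₂ (λ a b → a + b * 2) r≡ h≡)) pp))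
    byQuotient (suc t) h≡ r≡ = inj₂ (t , trans p≡ (trans (cong₂ (λ a b → a + b * 2) r≡ h≡) (l t)))
      where
      l : ∀ t → 1 + suc t * 2 ≡ 3 + 2 * t
      l = solve-∀
    byRemainder : ∀ r → p % 2 ≡ r → r < 2 → p ≡ 2 ⊎ Σ ℕ (λ t → p ≡ 3 + 2 * t)
    byRemainder zero r≡ _ with prime⇒irreducible pp (divides (p / 2) (trans p≡ (cong (_+ (p / 2) * 2) r≡)))
    ... | inj₁ ()
    ... | inj₂ 2≡p = inj₁ (sym 2≡p)
    byRemainder 1 r≡ _ = byQuotient (p / 2) refl r≡
    byRemainder (suc (suc r)) _ (s≤s (s≤s ()))

  coprime-prime : ∀ {p n} → Prime p → ¬ p ∣ n → Coprime p n
  coprime-prime pp p∤n {d} (d∣p , d∣n) with prime⇒irreducible pp d∣p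
  ... | inj₁ d≡1 = d≡1
  ... | inj₂ refl = ⊥-elim (p∤n d∣n)

  *-^ : ∀ a b m → (a * b) ^ m ≡ a ^ m * b ^ m
  *-^ a b zero    = refl
  *-^ a b (suc m) = trans (cong ((a * b) *_) (*-^ a b m)) (l a b (a ^ m) (b ^ m))
    where
    l : ∀ a b x y → (a * b) * (x * y) ≡ (a * x) * (b * y)
    l = solve-∀

  -- The main term nᵐ φ(n) of the formula, with m = k − 1.
  M : ℕ → ℕ → ℕ
  M m n = n ^ m * Ψ 1 n 0

  -- It transforms like Ψ k: by pᵏ under a repeated prime, multiplicatively under a new one.
  M-lift : ∀ m p n → p ∣ n → M m (p * n) ≡ p ^ suc m * M m n
  M-lift m p n p∣n = trans (cong₂ _*_ (*-^ p n m) (Ψ-lift 1 p n 0 p∣n)) (l p (p ^ m) (n ^ m) (Ψ 1 n 0))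
    where
    l : ∀ p a b g → (a * b) * ((p * 1) * g) ≡ (p * a) * (b * g)
    l = solve-∀

  M-mult : ∀ m p n → .{{NonZero n}} → Coprime p n → M m (p * n) ≡ M m p * M m n
  M-mult m p n cop = trans (cong₂ _*_ (*-^ p n m) (Ψ-multiplicative 1 p n 0 cop)) (l (p ^ m) (n ^ m) (Ψ 1 p 0) (Ψ 1 n 0))
    where
    l : ∀ a b g h → (a * b) * (g * h) ≡ (a * g) * (b * h)
    l = solve-∀

  odd-at-prime : ∀ j p → Prime p → Ψ (suc (2 * j)) p 0 ≡ M (2 * j) p
  odd-at-prime j p pp = byCase (prime-cases p pp)
    where
    byCase : p ≡ 2 ⊎ Σ ℕ (λ t → p ≡ 3 + 2 * t) → Ψ (suc (2 * j)) p 0 ≡ M (2 * j) p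
    byCase (inj₁ p≡2) = subst (λ q → Ψ (suc (2 * j)) q 0 ≡ M (2 * j) q) (sym p≡2)
      (trans (Ψ-two (2 * j) 0) (sym (trans (cong (2 ^ (2 * j) *_) (Ψ-two 0 0)) (*-identityʳ _))))
    byCase (inj₂ (t , p≡)) = subst (λ q → Ψ (suc (2 * j)) q 0 ≡ M (2 * j) q) (sym p≡)
      (OddPrimeValue.odd-value t (subst Prime p≡ pp) j)

  odd-formula : ∀ j n → n ≥ 1 → Ψ (suc (2 * j)) n 0 ≡ M (2 * j) n
  odd-formula j = factor-induction (λ n → Ψ (suc (2 * j)) n 0 ≡ M (2 * j) n) base step
    where
    base : Ψ (suc (2 * j)) 1 0 ≡ M (2 * j) 1
    base = trans (Ψ-one (suc (2 * j)) 0) (sym (cong₂ _*_ (^-zeroˡ (2 * j)) (Ψ-one 1 0)))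
    step : ∀ p n → Prime p → 1 ≤ n → Ψ (suc (2 * j)) n 0 ≡ M (2 * j) n →
           Ψ (suc (2 * j)) (p * n) 0 ≡ M (2 * j) (p * n)
    step p n pp 1≤n IH = byDivisibility (p ∣? n)
      where
      instance
        n≢0 : NonZero n
        n≢0 = >-nonZero 1≤n
      byDivisibility : Dec (p ∣ n) → Ψ (suc (2 * j)) (p * n) 0 ≡ M (2 * j) (p * n)
      byDivisibility (yes p∣n) =
        trans (Ψ-lift (suc (2 * j)) p n 0 p∣n) (trans (cong (p ^ suc (2 * j) *_) IH) (sym (M-lift (2 * j) p n p∣n)))
      byDivisibility (no p∤n) =
        trans (Ψ-multiplicative (suc (2 * j)) p n 0 (coprime-prime pp p∤n))
              (trans (cong₂ _*_ (odd-at-prime j p pp) IH) (sym (M-mult (2 * j) p n (coprime-prime pp p∤n))))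

  scale-formula : ∀ a x y c → ℕtoℚ x ≡ ℕtoℚ y *ℚ c → ℕtoℚ (a * x) ≡ ℕtoℚ (a * y) *ℚ c
  scale-formula a x y c x≡yc = begin
      ℕtoℚ (a * x)                  ≡⟨ ℕtoℚ-* a x ⟩
      ℕtoℚ a *ℚ ℕtoℚ x              ≡⟨ cong (ℕtoℚ a *ℚ_) x≡yc ⟩
      ℕtoℚ a *ℚ (ℕtoℚ y *ℚ c)       ≡⟨ sym (ℚP.*-assoc (ℕtoℚ a) (ℕtoℚ y) c) ⟩
      (ℕtoℚ a *ℚ ℕtoℚ y) *ℚ c       ≡⟨ cong (_*ℚ c) (sym (ℕtoℚ-* a y)) ⟩
      ℕtoℚ (a * y) *ℚ c             ∎
    where open ≡-Reasoning

  multiply-formulas : ∀ x y c x' y' c' → ℕtoℚ x ≡ ℕtoℚ y *ℚ c → ℕtoℚ x' ≡ ℕtoℚ y' *ℚ c' →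
                      ℕtoℚ (x * x') ≡ ℕtoℚ (y * y') *ℚ (c' *ℚ c)
  multiply-formulas x y c x' y' c' x≡yc x'≡y'c' = begin
      ℕtoℚ (x * x')                           ≡⟨ ℕtoℚ-* x x' ⟩
      ℕtoℚ x *ℚ ℕtoℚ x'                       ≡⟨ cong₂ _*ℚ_ x≡yc x'≡y'c' ⟩
      (ℕtoℚ y *ℚ c) *ℚ (ℕtoℚ y' *ℚ c')        ≡⟨ interchange (ℕtoℚ y) c (ℕtoℚ y') c' ⟩
      (ℕtoℚ y *ℚ ℕtoℚ y') *ℚ (c *ℚ c')        ≡⟨ cong₂ _*ℚ_ (sym (ℕtoℚ-* y y')) (ℚP.*-comm c c') ⟩
      ℕtoℚ (y * y') *ℚ (c' *ℚ c)              ∎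
    where open ≡-Reasoning

  module Even (i : ℕ) where

    -- k = K and m = k − 1; K computes to suc m, so the lemmas about M m apply to Ψ K.
    K m : ℕ
    K = 2 * suc i
    m = 2 * suc i ∸ 1

    at-prime : ∀ p n → Prime p → 1 ≤ n → ℕtoℚ (Ψ K p 0) ≡ ℕtoℚ (M m p) *ℚ newFactor K p (p * n)
    at-prime p n pp 1≤n = byCase (prime-cases p pp)
      where
      Value : ℕ → Set
      Value q = ℕtoℚ (Ψ K q 0) ≡ ℕtoℚ (M m q) *ℚ newFactor K q (q * n)
      byCase : p ≡ 2 ⊎ Σ ℕ (λ t → p ≡ 3 + 2 * t) → Value p
      byCase (inj₁ p≡2) = subst Value (sym p≡2)
        (trans (cong ℕtoℚ two) (trans (sym (ℚP.*-identityʳ _)) (cong (ℕtoℚ (M m 2) *ℚ_) (sym (newFactor-two K (2 * n))))))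
        where
        two : Ψ K 2 0 ≡ M m 2
        two = trans (Ψ-two m 0) (sym (trans (cong (2 ^ m *_) (Ψ-two 0 0)) (*-identityʳ _)))
      byCase (inj₂ (t , p≡)) = subst Value (sym p≡)
        (trans (OddPrimeValue.even-value t (subst Prime p≡ pp) i)
               (cong (ℕtoℚ (M m (3 + 2 * t)) *ℚ_) (sym (newFactor-odd K t ((3 + 2 * t) * n) (m≤m*n (3 + 2 * t) n {{>-nonZero 1≤n}})))))

    Formula : ℕ → Set
    Formula n = ℕtoℚ (Ψ K n 0) ≡ ℕtoℚ (M m n) *ℚ oddPrimeProduct K n

    formula : ∀ n → n ≥ 1 → Formula n
    formula = factor-induction Formula base step
      where
      base : Formula 1
      base = trans (cong ℕtoℚ (Ψ-one K 0))
                   (sym (trans (cong₂ _*ℚ_ (cong ℕtoℚ (cong₂ _*_ (^-zeroˡ m) (Ψ-one 1 0))) (oddPrimeProduct-one K))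
                               (ℚP.*-identityʳ 1ℚ)))
      step : ∀ p n → Prime p → 1 ≤ n → Formula n → Formula (p * n)
      step p n pp 1≤n IH = byDivisibility (p ∣? n)
        where
        instance
          n≢0 : NonZero n
          n≢0 = >-nonZero 1≤n
        byDivisibility : Dec (p ∣ n) → Formula (p * n)
        byDivisibility (yes p∣n) = begin
            ℕtoℚ (Ψ K (p * n) 0)
              ≡⟨ cong ℕtoℚ (Ψ-lift K p n 0 p∣n) ⟩
            ℕtoℚ (p ^ K * Ψ K n 0)
              ≡⟨ scale-formula (p ^ K) (Ψ K n 0) (M m n) (oddPrimeProduct K n) IH ⟩
            ℕtoℚ (p ^ K * M m n) *ℚ oddPrimeProduct K n
              ≡⟨ cong₂ (λ a b → ℕtoℚ a *ℚ b) (sym (M-lift m p n p∣n)) (sym (oddPrimeProduct-lift K p n pp 1≤n p∣n)) ⟩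
            ℕtoℚ (M m (p * n)) *ℚ oddPrimeProduct K (p * n) ∎
          where open ≡-Reasoning
        byDivisibility (no p∤n) = begin
            ℕtoℚ (Ψ K (p * n) 0)
              ≡⟨ cong ℕtoℚ (Ψ-multiplicative K p n 0 cop) ⟩
            ℕtoℚ (Ψ K p 0 * Ψ K n 0)
              ≡⟨ multiply-formulas (Ψ K p 0) (M m p) (newFactor K p (p * n)) (Ψ K n 0) (M m n) (oddPrimeProduct K n)
                                   (at-prime p n pp 1≤n) IH ⟩
            ℕtoℚ (M m p * M m n) *ℚ (oddPrimeProduct K n *ℚ newFactor K p (p * n))
              ≡⟨ cong₂ (λ a b → ℕtoℚ a *ℚ b) (sym (M-mult m p n cop)) (sym (oddPrimeProduct-new K p n pp 1≤n cop)) ⟩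
            ℕtoℚ (M m (p * n)) *ℚ oddPrimeProduct K (p * n) ∎
          where
          open ≡-Reasoning
          cop = coprime-prime pp p∤n

  odd-shape : ∀ k → k % 2 ≡ 1 → Σ ℕ λ j → k ≡ suc (2 * j)
  odd-shape k e = k / 2 , trans (m≡m%n+[m/n]*n k 2) (trans (cong (_+ (k / 2) * 2) e) (l (k / 2)))
    where
    l : ∀ q → 1 + q * 2 ≡ suc (2 * q)
    l = solve-∀

  even-shape : ∀ k → k ≥ 1 → k % 2 ≡ 0 → Σ ℕ λ i → k ≡ 2 * suc i
  even-shape k k≥1 e = byHalf (k / 2) refl
    where
    k≡ : k ≡ (k / 2) * 2
    k≡ = trans (m≡m%n+[m/n]*n k 2) (cong (_+ (k / 2) * 2) e)
    byHalf : ∀ h → k / 2 ≡ h → Σ ℕ λ i → k ≡ 2 * suc i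
    byHalf zero    h≡ = ⊥-elim (<⇒≱ k≥1 (≤-reflexive (trans k≡ (cong (_* 2) h≡))))
    byHalf (suc i) h≡ = i , trans k≡ (trans (cong (_* 2) h≡) (*-comm (suc i) 2))

open Counting using (Ψ; Φ≡Ψ; φ≡Ψ)
open Multiplicative using (Ψ-multiplicative)
open Formula using (odd-shape; odd-formula; even-shape; module Even)

theorem1 : (k : ℕ) → k ≥ 1 →
    ((m n : ℕ) → m ≥ 1 → n ≥ 1 → Coprime m n → Φ k (m * n) ≡ Φ k m * Φ k n)
    × ((n : ℕ) → n ≥ 1 → k % 2 ≡ 1 → Φ k n ≡ n ^ (k ∸ 1) * φ n)
    × ((n : ℕ) → n ≥ 1 → k % 2 ≡ 0 →
        ℕtoℚ (Φ k n) ≡ ℕtoℚ (n ^ (k ∸ 1) * φ n) *ℚ oddPrimeProduct k n)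
theorem1 k k≥1 = multiplicative , odd , even
  where
  open ≡-Reasoning
  multiplicative : (m n : ℕ) → m ≥ 1 → n ≥ 1 → Coprime m n → Φ k (m * n) ≡ Φ k m * Φ k n
  multiplicative m n _ n≥1 cop = begin
    Φ k (m * n)          ≡⟨ Φ≡Ψ k (m * n) ⟩
    Ψ k (m * n) 0        ≡⟨ Ψ-multiplicative k m n 0 {{>-nonZero n≥1}} cop ⟩
    Ψ k m 0 * Ψ k n 0    ≡⟨ sym (cong₂ _*_ (Φ≡Ψ k m) (Φ≡Ψ k n)) ⟩
    Φ k m * Φ k n        ∎
  odd : (n : ℕ) → n ≥ 1 → k % 2 ≡ 1 → Φ k n ≡ n ^ (k ∸ 1) * φ n
  odd n n≥1 k-odd = fromShape (odd-shape k k-odd)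
    where
    fromShape : Σ ℕ (λ j → k ≡ suc (2 * j)) → Φ k n ≡ n ^ (k ∸ 1) * φ n
    fromShape (j , k≡) = begin
      Φ k n
        ≡⟨ Φ≡Ψ k n ⟩
      Ψ k n 0
        ≡⟨ subst (λ K → Ψ K n 0 ≡ n ^ (K ∸ 1) * Ψ 1 n 0) (sym k≡) (odd-formula j n n≥1) ⟩
      n ^ (k ∸ 1) * Ψ 1 n 0
        ≡⟨ cong (n ^ (k ∸ 1) *_) (sym (φ≡Ψ n)) ⟩
      n ^ (k ∸ 1) * φ n ∎
  even : (n : ℕ) → n ≥ 1 → k % 2 ≡ 0 → ℕtoℚ (Φ k n) ≡ ℕtoℚ (n ^ (k ∸ 1) * φ n) *ℚ oddPrimeProduct k n
  even n n≥1 k-even = fromShape (even-shape k k≥1 k-even)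
    where
    fromShape : Σ ℕ (λ i → k ≡ 2 * suc i) → ℕtoℚ (Φ k n) ≡ ℕtoℚ (n ^ (k ∸ 1) * φ n) *ℚ oddPrimeProduct k n
    fromShape (i , k≡) = begin
      ℕtoℚ (Φ k n)
        ≡⟨ cong ℕtoℚ (Φ≡Ψ k n) ⟩
      ℕtoℚ (Ψ k n 0)
        ≡⟨ subst (λ K → ℕtoℚ (Ψ K n 0) ≡ ℕtoℚ (n ^ (K ∸ 1) * Ψ 1 n 0) *ℚ oddPrimeProduct K n)
                 (sym k≡) (Even.formula i n n≥1) ⟩
      ℕtoℚ (n ^ (k ∸ 1) * Ψ 1 n 0) *ℚ oddPrimeProduct k n
        ≡⟨ cong (λ f → ℕtoℚ (n ^ (k ∸ 1) * f) *ℚ oddPrimeProduct k n) (sym (φ≡Ψ n)) ⟩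
      ℕtoℚ (n ^ (k ∸ 1) * φ n) *ℚ oddPrimeProduct k n ∎
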